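{- The map $(\mathfrak{Lie}(B),\{ -,-\}_A)\to\mathrm{End}_{\mathbb{Q}}(\mathbb{Q}\langle B\rangle^0)$, $\psi\mapsto\sigma^0_\psi$, is a Lie algebra morphism, where $\mathrm{End}_{\mathbb{Q}}(\mathbb{Q}\langle B\rangle^0)$ carries the commutator bracket $[u,v]=u\circ v-v\circ u$; i.e. it is a Lie algebra action of $(\mathfrak{Lie}(B),\{ -,-\}_A)$ on $\mathbb{Q}\langle B\rangle^0$ by linear endomorphisms.
   Context: Let $B=\{b_0,b_1,b_2,\dots\}$, $\mathbb{Q}\langle B\rangle$ the free associative $\mathbb{Q}$-algebra on $B$, and $\mathfrak{Lie}(B)\subset\mathbb{Q}\langle B\rangle$ the free Lie algebra on $B$. Let $\mathbb{Q}\langle B\rangle^0$ be the span of words not ending in $b_0$ and $\pi_0:\mathbb{Q}\langle B\rangle\to\mathbb{Q}\langle B\rangle^0$ the projection killing words ending in $b_0$ and fixing other words. For a word $w=b_0^{m_1}b_{k_1}\cdots b_0^{m_d}b_{k_d}b_0^{m_{d+1}}$ ($d\ge1$, $k_i\ge1$, $m_i\ge0$), $\mathbf{k}=(k_1,\dots,k_d)$ and $\mathbf{l}\in\mathbb{Z}_{>0}^d$, let $w(\mathbf{l})$ be obtained by replacing each $b_{k_i}$ by $b_{l_i}$, $|\mathbf{k}|=\sum k_i$, $\binom{\mathbf{k}-1}{\mathbf{l}-1}=\prod_i\binom{k_i-1}{l_i-1}$, $\mathbf{l}\le\mathbf{k}$ componentwise. Let $\partial_w$ be the derivation of $\mathbb{Q}\langle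 B\rangle$ with $\partial_w(b_0)=0$ and $\partial_w(b_i)=\sum_{\mathbf{l}\le\mathbf{k}}(-1)^{|\mathbf{k}|+|\mathbf{l}|}\binom{\mathbf{k}-1}{\mathbf{l}-1}[b_{i+|\mathbf{k}|-|\mathbf{l}|},w(\mathbf{l})]$ for $i\ge1$; if $w=b_0^m$ ($m\ge1$) then $\partial_w(b_0)=0$, $\partial_w(b_i)=[b_i,w]$; extend linearly in $w$. The bracket $\{\psi_1,\psi_2\}_A=\partial_{\psi_1}(\psi_2)-\partial_{\psi_2}(\psi_1)+[\psi_1,\psi_2]$ is a Lie bracket on $\mathfrak{Lie}(B)$. For $\psi\in\mathfrak{Lie}(B)$ let $\sigma_\psi=\ell_\psi+\partial_\psi$ ($\ell_\psi$ left multiplication by $\psi$); it maps $\mathbb{Q}\langle B\rangle b_0$ into itself, and $\sigma^0_\psi$ denotes the unique linear endomorphism of $\mathbb{Q}\langle B\rangle^0$ with $\pi_0\circ\sigma_\psi=\sigma^0_\psi\circ\pi_0$. -}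

module Defs where

open import Data.Nat as ℕ using (ℕ; zero; suc)
open import Data.Nat.Combinatorics using (_C_)
open import Data.Integer using (+_)
open import Data.Rational as ℚ using (ℚ; 0ℚ; 1ℚ)
open import Data.List using (List; []; _∷_; _++_; map; concatMap; foldr; filter; upTo)
open import Data.List.Properties using (≡-dec)
open import Data.Product using (_×_; _,_)
open import Data.Bool using (Bool; true; false)
open import Relation.Binary.PropositionalEquality using (_≡_)
open import Relation.Nullary using (yes; no; ¬_)
open import Relation.Nullary.Decidable using (¬?)
open import Relation.Unary using (Decidable)

-- Letters b_i are represented by their index i : ℕ; a word is a list of indices.
Word : Set
Word = List ℕ

-- An element of ℚ⟨B⟩, represented as a finite formal linear combination of words.
-- Two representations denote the same element iff all coefficients agree (_≈_ below).
Poly : Set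
Poly = List (ℚ × Word)

coeff : Poly → Word → ℚ
coeff [] w = 0ℚ
coeff ((c , v) ∷ p) w with ≡-dec ℕ._≟_ v w
... | yes _ = c ℚ.+ coeff p w
... | no  _ = coeff p w

infix 4 _≈_
_≈_ : Poly → Poly → Set
p ≈ q = ∀ w → coeff p w ≡ coeff q w

𝟘 : Poly
𝟘 = []

infixl 6 _⊕_ _⊖_
infixl 7 _⊛_ _·_

_⊕_ : Poly → Poly → Poly
p ⊕ q = p ++ q

_·_ : ℚ → Poly → Poly
a · p = map (λ { (c , w) → (a ℚ.* c , w) }) p

_⊖_ : Poly → Poly → Poly
p ⊖ q = p ⊕ (ℚ.- 1ℚ) · q

_⊛_ : Poly → Poly → Poly
p ⊛ q = concatMap (λ { (c , v) → map (λ { (d , w) → (c ℚ.* d , v ++ w) }) q }) p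

b : ℕ → Poly
b i = (1ℚ , i ∷ []) ∷ []

mono : Word → Poly
mono w = (1ℚ , w) ∷ []

⟦_,_⟧ : Poly → Poly → Poly
⟦ p , q ⟧ = p ⊛ q ⊖ q ⊛ p

ΣL : {A : Set} → (A → Poly) → List A → Poly
ΣL f xs = foldr (λ x acc → f x ⊕ acc) 𝟘 xs

-- Free Lie algebra 𝔏𝔦𝔢(B): the Lie subalgebra of ℚ⟨B⟩ generated by B
-- (closed under ≈ so that it is a subset of ℚ⟨B⟩, not of its representations).
data IsLie : Poly → Set where
  lie-gen   : ∀ i → IsLie (b i)
  lie-zero  : IsLie 𝟘
  lie-add   : ∀ {p q} → IsLie p → IsLie q → IsLie (p ⊕ q)
  lie-scale : ∀ a {p} → IsLie p → IsLie (a · p)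
  lie-br    : ∀ {p q} → IsLie p → IsLie q → IsLie ⟦ p , q ⟧
  lie-resp  : ∀ {p q} → p ≈ q → IsLie p → IsLie q

endsIn0 : Word → Bool
endsIn0 [] = false
endsIn0 (x ∷ []) with x
... | zero  = true
... | suc _ = false
endsIn0 (_ ∷ y ∷ w) = endsIn0 (y ∷ w)

π₀ : Poly → Poly
π₀ [] = []
π₀ ((c , w) ∷ p) with endsIn0 w
... | true  = π₀ p
... | false = (c , w) ∷ π₀ p

-- membership in ℚ⟨B⟩⁰ (span of words not ending in b_0)
In⁰ : Poly → Set
In⁰ x = π₀ x ≈ x

derivWord : (ℕ → Poly) → Word → Poly
derivWord d [] = 𝟘
derivWord d (x ∷ w) = d x ⊛ mono w ⊕ mono (x ∷ []) ⊛ derivWord d w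

derivExt : (ℕ → Poly) → Poly → Poly
derivExt d p = ΣL (λ { (c , w) → c · derivWord d w }) p

ι : ℕ → ℚ
ι n = (+ n) ℚ./ 1

sgn : ℕ → ℚ
sgn zero = 1ℚ
sgn (suc j) = ℚ.- sgn j

-- For a word w with nonzero letters k = (k_1,…,k_d): list of all
-- ( (-1)^{|k|+|l|} binom(k-1,l-1) , |k| - |l| , w(l) )  for 1 ≤ l ≤ k.
-- Writing l_i = k_i - j with 0 ≤ j ≤ k_i - 1: binom(k_i-1, l_i-1) = binom(k_i-1, j),
-- sign (-1)^{k_i+l_i} = (-1)^j.
opts : Word → List (ℚ × ℕ × Word)
opts [] = (1ℚ , 0 , []) ∷ []
opts (zero ∷ w) = map (λ { (c , s , v) → (c , s , zero ∷ v) }) (opts w)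
opts (suc n ∷ w) =
  concatMap (λ j → map (λ { (c , s , v) →
      (sgn j ℚ.* ι (n C j) ℚ.* c , j ℕ.+ s , (suc n ℕ.∸ j) ∷ v) }) (opts w))
    (upTo (suc n))

-- ∂_w on letters, for a word w. When w = b_0^m (d = 0) this gives ∂_w(b_i) = [b_i, w].
∂word : Word → ℕ → Poly
∂word w zero = 𝟘
∂word w (suc i) = ΣL (λ { (c , s , v) → c · ⟦ b (suc i ℕ.+ s) , mono v ⟧ }) (opts w)

∂letter : Poly → ℕ → Poly
∂letter ψ i = ΣL (λ { (c , w) → c · ∂word w i }) ψ

∂ : Poly → Poly → Poly
∂ ψ = derivExt (∂letter ψ)

⟪_,_⟫A : Poly → Poly → Poly
⟪ ψ₁ , ψ₂ ⟫A = ∂ ψ₁ ψ₂ ⊖ ∂ ψ₂ ψ₁ ⊕ ⟦ ψ₁ , ψ₂ ⟧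

σ : Poly → Poly → Poly
σ ψ x = ψ ⊛ x ⊕ ∂ ψ x

-- σ⁰_ψ on ℚ⟨B⟩⁰: since π₀ ∘ σ_ψ = σ⁰_ψ ∘ π₀ and π₀ x = x on ℚ⟨B⟩⁰,
-- σ⁰_ψ(x) = π₀(σ_ψ(x)) for x ∈ ℚ⟨B⟩⁰.
σ⁰ : Poly → Poly → Poly
σ⁰ ψ x = π₀ (σ ψ x)

module Submission where

-- Everything is transposed: a polynomial p is determined by its pairings ⟨ p ∣ h ⟩ = Σ_w coeff p w · h w
-- with functions h : Word → ℚ, and each operation on ℚ⟨B⟩ has an explicit transpose acting on such h.
--
-- The heart is the letter identity ∂_{ {ψ₁,ψ₂} } b_i = [∂_ψ₁, ∂_ψ₂] b_i. In ∂_w b_i = Σ ± [b_{i+s}, w(𝐥)],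
-- read umbrally, every letter b_k of w becomes (b − x)^(k−1) with x counting the shift s. A substitution
-- identity for this expansion shows that ∂_ψ commutes with it, so ∂_ψ₁ ∂_ψ₂ b_i − ∂_{∂_ψ₁ ψ₂} b_i consists
-- of the terms in which ∂_ψ₁ hits the letter b_{i+s}; antisymmetrised, these give ∂_{[ψ₁,ψ₂]} b_i by the
-- Jacobi identity. A derivation is determined by its values on letters, so ∂_{ {ψ₁,ψ₂} } = [∂_ψ₁, ∂_ψ₂],
-- and together with [ℓ_ψ, ∂_φ] = −ℓ_{∂_φ ψ} this gives σ_{ {ψ₁,ψ₂} } = [σ_ψ₁, σ_ψ₂] on ℚ⟨B⟩. Finally σ_ψ
-- preserves ℚ⟨B⟩b₀, so π₀ carries both identities over to σ⁰.

open import Defs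
open import Data.Nat as ℕ using (ℕ; zero; suc; _∸_)
import Data.Nat.Properties as ℕP
import Data.Nat.Coprimality as Coprime
open import Data.Nat.Combinatorics using (_C_; nCk+nC[k+1]≡[n+1]C[k+1]; k>n⇒nCk≡0)
open import Data.Integer as ℤ using ()
import Data.Integer.Properties as ℤP
open import Data.Rational as ℚ using (ℚ; 0ℚ; 1ℚ; mkℚ; _+_; _*_; -_; _-_)
import Data.Rational.Properties as ℚP
open import Data.Rational.Solver using (module +-*-Solver)
open import Data.List using (List; []; _∷_; _++_; map; concatMap; applyUpTo)
import Data.List.Properties as LP
open import Data.List.Properties using (≡-dec)
open import Data.Product using (_×_; _,_; uncurry)
open import Data.Bool using (true; false; if_then_else_)
open import Relation.Nullary using (yes; no)
open import Function using (_∘_)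
open import Relation.Binary.PropositionalEquality
open ≡-Reasoning
open +-*-Solver using (solve; _:+_; _:*_; :-_; _:-_; _:=_; con)

-- Pairing formal linear combinations with functions

infix 4 ⟨_∣_⟩

⟨_∣_⟩ : {K : Set} → List (ℚ × K) → (K → ℚ) → ℚ
⟨ [] ∣ h ⟩ = 0ℚ
⟨ (c , k) ∷ p ∣ h ⟩ = c * h k + ⟨ p ∣ h ⟩

module _ {K : Set} where

  pair-cong : (p : List (ℚ × K)) {f g : K → ℚ} → (∀ k → f k ≡ g k) → ⟨ p ∣ f ⟩ ≡ ⟨ p ∣ g ⟩
  pair-cong [] f≗g = refl
  pair-cong ((c , k) ∷ p) f≗g = cong₂ (λ x y → c * x + y) (f≗g k) (pair-cong p f≗g)

  pair-++ : (p q : List (ℚ × K)) (h : K → ℚ) → ⟨ p ++ q ∣ h ⟩ ≡ ⟨ p ∣ h ⟩ + ⟨ q ∣ h ⟩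
  pair-++ [] q h = sym (ℚP.+-identityˡ _)
  pair-++ ((c , k) ∷ p) q h = begin
    c * h k + ⟨ p ++ q ∣ h ⟩          ≡⟨ cong (c * h k +_) (pair-++ p q h) ⟩
    c * h k + (⟨ p ∣ h ⟩ + ⟨ q ∣ h ⟩)  ≡⟨ ℚP.+-assoc (c * h k) _ _ ⟨
    c * h k + ⟨ p ∣ h ⟩ + ⟨ q ∣ h ⟩    ∎

  pair-add : (p : List (ℚ × K)) (f g : K → ℚ) → ⟨ p ∣ (λ k → f k + g k) ⟩ ≡ ⟨ p ∣ f ⟩ + ⟨ p ∣ g ⟩
  pair-add [] f g = refl
  pair-add ((c , k) ∷ p) f g = begin
    c * (f k + g k) + ⟨ p ∣ (λ k → f k + g k) ⟩  ≡⟨ cong (c * (f k + g k) +_) (pair-add p f g) ⟩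
    c * (f k + g k) + (⟨ p ∣ f ⟩ + ⟨ p ∣ g ⟩)    ≡⟨ solve 5 (λ c x y a b → c :* (x :+ y) :+ (a :+ b) := (c :* x :+ a) :+ (c :* y :+ b))
                                                       refl c (f k) (g k) ⟨ p ∣ f ⟩ ⟨ p ∣ g ⟩ ⟩
    (c * f k + ⟨ p ∣ f ⟩) + (c * g k + ⟨ p ∣ g ⟩) ∎

  pair-scale : (p : List (ℚ × K)) (a : ℚ) (f : K → ℚ) → ⟨ p ∣ (λ k → a * f k) ⟩ ≡ a * ⟨ p ∣ f ⟩
  pair-scale [] a f = sym (ℚP.*-zeroʳ a)
  pair-scale ((c , k) ∷ p) a f = begin
    c * (a * f k) + ⟨ p ∣ (λ k → a * f k) ⟩ ≡⟨ cong (c * (a * f k) +_) (pair-scale p a f) ⟩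
    c * (a * f k) + a * ⟨ p ∣ f ⟩           ≡⟨ solve 4 (λ c a x y → c :* (a :* x) :+ a :* y := a :* (c :* x :+ y))
                                                  refl c a (f k) ⟨ p ∣ f ⟩ ⟩
    a * (c * f k + ⟨ p ∣ f ⟩)               ∎

  pair-neg : (p : List (ℚ × K)) (f : K → ℚ) → ⟨ p ∣ (λ k → - f k) ⟩ ≡ - ⟨ p ∣ f ⟩
  pair-neg [] f = refl
  pair-neg ((c , k) ∷ p) f rewrite pair-neg p f =
    solve 3 (λ c x y → c :* (:- x) :+ (:- y) := :- (c :* x :+ y)) refl c (f k) ⟨ p ∣ f ⟩

  pair-sub : (p : List (ℚ × K)) (f g : K → ℚ) → ⟨ p ∣ (λ k → f k - g k) ⟩ ≡ ⟨ p ∣ f ⟩ - ⟨ p ∣ g ⟩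
  pair-sub p f g = trans (pair-add p f (λ k → - g k)) (cong (⟨ p ∣ f ⟩ +_) (pair-neg p g))

  pair-vanish : (p : List (ℚ × K)) {f : K → ℚ} → (∀ k → f k ≡ 0ℚ) → ⟨ p ∣ f ⟩ ≡ 0ℚ
  pair-vanish [] f≗0 = refl
  pair-vanish ((c , k) ∷ p) f≗0 rewrite f≗0 k | pair-vanish p f≗0 = solve 1 (λ c → c :* con 0ℚ :+ con 0ℚ := con 0ℚ) refl c

pair-swap : {K L : Set} (p : List (ℚ × K)) (q : List (ℚ × L)) (f : K → L → ℚ) →
            ⟨ p ∣ (λ k → ⟨ q ∣ f k ⟩) ⟩ ≡ ⟨ q ∣ (λ l → ⟨ p ∣ (λ k → f k l) ⟩) ⟩
pair-swap [] q f = sym (pair-vanish q (λ _ → refl))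
pair-swap ((c , k) ∷ p) q f = begin
  c * ⟨ q ∣ f k ⟩ + ⟨ p ∣ (λ k′ → ⟨ q ∣ f k′ ⟩) ⟩
    ≡⟨ cong₂ _+_ (pair-scale q c (f k)) (sym (pair-swap p q f)) ⟨
  ⟨ q ∣ (λ l → c * f k l) ⟩ + ⟨ q ∣ (λ l → ⟨ p ∣ (λ k′ → f k′ l) ⟩) ⟩
    ≡⟨ pair-add q _ _ ⟨
  ⟨ q ∣ (λ l → c * f k l + ⟨ p ∣ (λ k′ → f k′ l) ⟩) ⟩ ∎

pair-map : {K L : Set} (F : ℚ × K → ℚ × L) (g : K → L) → (∀ c k → F (c , k) ≡ (c , g k)) →
           (p : List (ℚ × K)) (h : L → ℚ) → ⟨ map F p ∣ h ⟩ ≡ ⟨ p ∣ (λ k → h (g k)) ⟩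
pair-map F g F≡ [] h = refl
pair-map F g F≡ ((c , k) ∷ p) h rewrite F≡ c k = cong (c * h (g k) +_) (pair-map F g F≡ p h)

pair-map-scaled : {K L : Set} (F : ℚ × K → ℚ × L) (a : ℚ) (g : K → L) → (∀ c k → F (c , k) ≡ (a * c , g k)) →
                  (p : List (ℚ × K)) (h : L → ℚ) → ⟨ map F p ∣ h ⟩ ≡ a * ⟨ p ∣ (λ k → h (g k)) ⟩
pair-map-scaled F a g F≡ [] h = sym (ℚP.*-zeroʳ a)
pair-map-scaled F a g F≡ ((c , k) ∷ p) h rewrite F≡ c k | pair-map-scaled F a g F≡ p h =
  solve 4 (λ a c x y → a :* c :* x :+ a :* y := a :* (c :* x :+ y)) refl a c (h (g k)) ⟨ p ∣ (λ k → h (g k)) ⟩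

sumBelow : ℕ → (ℕ → ℚ) → ℚ
sumBelow zero F = 0ℚ
sumBelow (suc n) F = F 0 + sumBelow n (λ j → F (suc j))

pair-concatMap-applyUpTo : {K : Set} (G : ℕ → List (ℚ × K)) (f : ℕ → ℕ) (n : ℕ) (h : K → ℚ) →
  ⟨ concatMap G (applyUpTo f n) ∣ h ⟩ ≡ sumBelow n (λ j → ⟨ G (f j) ∣ h ⟩)
pair-concatMap-applyUpTo G f zero h = refl
pair-concatMap-applyUpTo G f (suc n) h =
  trans (pair-++ (G (f 0)) _ h) (cong (⟨ G (f 0) ∣ h ⟩ +_) (pair-concatMap-applyUpTo G (λ j → f (suc j)) n h))

sumBelow-cong : (n : ℕ) {F G : ℕ → ℚ} → (∀ j → j ℕ.< n → F j ≡ G j) → sumBelow n F ≡ sumBelow n G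
sumBelow-cong zero F≗G = refl
sumBelow-cong (suc n) F≗G = cong₂ _+_ (F≗G 0 (ℕ.s≤s ℕ.z≤n)) (sumBelow-cong n (λ j j<n → F≗G (suc j) (ℕ.s≤s j<n)))

sumBelow-pair : {K : Set} (n : ℕ) (p : List (ℚ × K)) (f : ℕ → K → ℚ) →
                sumBelow n (λ j → ⟨ p ∣ f j ⟩) ≡ ⟨ p ∣ (λ k → sumBelow n (λ j → f j k)) ⟩
sumBelow-pair zero p f = sym (pair-vanish p (λ _ → refl))
sumBelow-pair (suc n) p f =
  trans (cong (⟨ p ∣ f 0 ⟩ +_) (sumBelow-pair n p (λ j → f (suc j)))) (sym (pair-add p (f 0) _))

sumBelow-sub : (n : ℕ) (F G : ℕ → ℚ) → sumBelow n (λ j → F j - G j) ≡ sumBelow n F - sumBelow n G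
sumBelow-sub zero F G = refl
sumBelow-sub (suc n) F G rewrite sumBelow-sub n (λ j → F (suc j)) (λ j → G (suc j)) =
  solve 4 (λ a b c d → (a :- b) :+ (c :- d) := (a :+ c) :- (b :+ d)) refl (F 0) (G 0) _ _

sumBelow-dropLast : (n : ℕ) (F : ℕ → ℚ) → F n ≡ 0ℚ → sumBelow (suc n) F ≡ sumBelow n F
sumBelow-dropLast zero F F0≡0 rewrite F0≡0 = refl
sumBelow-dropLast (suc n) F Fn≡0 = cong (F 0 +_) (sumBelow-dropLast n (λ j → F (suc j)) Fn≡0)

ι≡mkℚ : ∀ n → ι n ≡ mkℚ (ℤ.+ n) 0 (Coprime.sym (Coprime.1-coprimeTo n))
ι≡mkℚ n = ℚP.normalize-coprime _

ι-homo-+ : ∀ m n → ι (m ℕ.+ n) ≡ ι m + ι n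
ι-homo-+ m n rewrite ι≡mkℚ m | ι≡mkℚ n =
  cong (ℚ._/ 1) (sym (cong₂ ℤ._+_ (ℤP.*-identityʳ (ℤ.+ m)) (ℤP.*-identityʳ (ℤ.+ n))))

signedBinom : ℕ → ℕ → ℚ
signedBinom m j = sgn j * ι (m C j)

signedBinom-pascal : ∀ n j → signedBinom (suc n) (suc j) ≡ signedBinom n (suc j) - signedBinom n j
signedBinom-pascal n j = begin
  (- sgn j) * ι (suc n C suc j)             ≡⟨ cong (λ c → (- sgn j) * ι c) (nCk+nC[k+1]≡[n+1]C[k+1] n j) ⟨
  (- sgn j) * ι (n C j ℕ.+ n C suc j)       ≡⟨ cong ((- sgn j) *_) (ι-homo-+ (n C j) (n C suc j)) ⟩
  (- sgn j) * (ι (n C j) + ι (n C suc j))   ≡⟨ solve 3 (λ s a b → (:- s) :* (a :+ b) := (:- s) :* b :- s :* a)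
                                                 refl (sgn j) (ι (n C j)) (ι (n C suc j)) ⟩
  signedBinom n (suc j) - signedBinom n j   ∎

signedBinom-beyond : ∀ n → signedBinom n (suc n) ≡ 0ℚ
signedBinom-beyond n = trans (cong (λ c → sgn (suc n) * ι c) (k>n⇒nCk≡0 (ℕP.n<1+n n))) (ℚP.*-zeroʳ (sgn (suc n)))

-- diffPow m F is the expansion of (Y − X)ᵐ, reading Xʲ Yˡ as F j l.
diffPow : ℕ → (ℕ → ℕ → ℚ) → ℚ
diffPow m F = sumBelow (suc m) (λ j → signedBinom m j * F j (m ∸ j))

diffPow-cong : (m : ℕ) {F G : ℕ → ℕ → ℚ} → (∀ j l → F j l ≡ G j l) → diffPow m F ≡ diffPow m G
diffPow-cong m F≗G = sumBelow-cong (suc m) (λ j _ → cong (signedBinom m j *_) (F≗G j (m ∸ j)))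

diffPow-sub : (m : ℕ) (F G : ℕ → ℕ → ℚ) → diffPow m (λ j l → F j l - G j l) ≡ diffPow m F - diffPow m G
diffPow-sub m F G = trans
  (sumBelow-cong (suc m) (λ j _ →
    solve 3 (λ c x y → c :* (x :- y) := c :* x :- c :* y) refl (signedBinom m j) (F j (m ∸ j)) (G j (m ∸ j))))
  (sumBelow-sub (suc m) (λ j → signedBinom m j * F j (m ∸ j)) (λ j → signedBinom m j * G j (m ∸ j)))

diffPow-pair : {K : Set} (m : ℕ) (p : List (ℚ × K)) (f : ℕ → ℕ → K → ℚ) →
               diffPow m (λ j l → ⟨ p ∣ f j l ⟩) ≡ ⟨ p ∣ (λ k → diffPow m (λ j l → f j l k)) ⟩
diffPow-pair m p f = trans
  (sumBelow-cong (suc m) (λ j _ → sym (pair-scale p (signedBinom m j) (f j (m ∸ j)))))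
  (sumBelow-pair (suc m) p (λ j k → signedBinom m j * f j (m ∸ j) k))

diffPow-suc : (n : ℕ) (F : ℕ → ℕ → ℚ) →
              diffPow (suc n) F ≡ diffPow n (λ j l → F j (suc l)) - diffPow n (λ j l → F (suc j) l)
diffPow-suc n F = begin
  F₀ + sumBelow (suc n) (λ j → signedBinom (suc n) (suc j) * G j)
    ≡⟨ cong (F₀ +_) (sumBelow-cong (suc n) (λ j _ → pascal j)) ⟩
  F₀ + sumBelow (suc n) (λ j → signedBinom n (suc j) * G j - signedBinom n j * G j)
    ≡⟨ cong (F₀ +_) (sumBelow-sub (suc n) (λ j → signedBinom n (suc j) * G j) (λ j → signedBinom n j * G j)) ⟩
  F₀ + (sumBelow (suc n) (λ j → signedBinom n (suc j) * G j) - B)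
    ≡⟨ cong (λ a → F₀ + (a - B)) (sumBelow-dropLast n (λ j → signedBinom n (suc j) * G j) top-vanishes) ⟩
  F₀ + (sumBelow n (λ j → signedBinom n (suc j) * G j) - B)
    ≡⟨ cong (λ a → F₀ + (a - B)) (sumBelow-cong n (λ j j<n →
         cong (λ l → signedBinom n (suc j) * F (suc j) l) (ℕP.+-∸-assoc 1 j<n))) ⟩
  F₀ + (A - B)
    ≡⟨ ℚP.+-assoc F₀ A (- B) ⟨
  F₀ + A - B ∎
  where
  F₀ = signedBinom n 0 * F 0 (suc n)
  G : ℕ → ℚ
  G j = F (suc j) (n ∸ j)
  A = sumBelow n (λ j → signedBinom n (suc j) * F (suc j) (suc (n ∸ suc j)))
  B = diffPow n (λ j l → F (suc j) l)
  pascal : ∀ j → signedBinom (suc n) (suc j) * G j ≡ signedBinom n (suc j) * G j - signedBinom n j * G j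
  pascal j = trans (cong (_* G j) (signedBinom-pascal n j))
    (solve 3 (λ a b g → (a :- b) :* g := a :* g :- b :* g) refl (signedBinom n (suc j)) (signedBinom n j) (G j))
  top-vanishes : signedBinom n (suc n) * G n ≡ 0ℚ
  top-vanishes = trans (cong (_* G n) (signedBinom-beyond n)) (ℚP.*-zeroˡ (G n))

pair-· : (a : ℚ) (p : Poly) (h : Word → ℚ) → ⟨ a · p ∣ h ⟩ ≡ a * ⟨ p ∣ h ⟩
pair-· a p h = pair-map-scaled _ a (λ w → w) (λ c w → refl) p h

pair-·⊕· : (a₁ a₂ : ℚ) (p₁ p₂ : Poly) (h : Word → ℚ) →
           ⟨ a₁ · p₁ ⊕ a₂ · p₂ ∣ h ⟩ ≡ a₁ * ⟨ p₁ ∣ h ⟩ + a₂ * ⟨ p₂ ∣ h ⟩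
pair-·⊕· a₁ a₂ p₁ p₂ h = trans (pair-++ (a₁ · p₁) (a₂ · p₂) h) (cong₂ _+_ (pair-· a₁ p₁ h) (pair-· a₂ p₂ h))

pair-⊖ : (p q : Poly) (h : Word → ℚ) → ⟨ p ⊖ q ∣ h ⟩ ≡ ⟨ p ∣ h ⟩ - ⟨ q ∣ h ⟩
pair-⊖ p q h = begin
  ⟨ p ⊖ q ∣ h ⟩                  ≡⟨ pair-++ p ((- 1ℚ) · q) h ⟩
  ⟨ p ∣ h ⟩ + ⟨ (- 1ℚ) · q ∣ h ⟩  ≡⟨ cong (⟨ p ∣ h ⟩ +_) (pair-· (- 1ℚ) q h) ⟩
  ⟨ p ∣ h ⟩ + (- 1ℚ) * ⟨ q ∣ h ⟩  ≡⟨ solve 2 (λ x y → x :+ (:- con 1ℚ) :* y := x :- y) refl ⟨ p ∣ h ⟩ ⟨ q ∣ h ⟩ ⟩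
  ⟨ p ∣ h ⟩ - ⟨ q ∣ h ⟩          ∎

pair-⊛ : (p q : Poly) (h : Word → ℚ) → ⟨ p ⊛ q ∣ h ⟩ ≡ ⟨ p ∣ (λ u → ⟨ q ∣ (λ v → h (u ++ v)) ⟩) ⟩
pair-⊛ [] q h = refl
pair-⊛ ((c , u) ∷ p) q h =
  trans (pair-++ (map _ q) (p ⊛ q) h) (cong₂ _+_ (pair-map-scaled _ c (u ++_) (λ d v → refl) q h) (pair-⊛ p q h))

pair-mono : (w : Word) (h : Word → ℚ) → ⟨ mono w ∣ h ⟩ ≡ h w
pair-mono w h = solve 1 (λ x → con 1ℚ :* x :+ con 0ℚ := x) refl (h w)

pair-⟦⟧ : (p q : Poly) (h : Word → ℚ) →
  ⟨ ⟦ p , q ⟧ ∣ h ⟩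
  ≡ ⟨ p ∣ (λ u → ⟨ q ∣ (λ v → h (u ++ v)) ⟩) ⟩ - ⟨ q ∣ (λ v → ⟨ p ∣ (λ u → h (v ++ u)) ⟩) ⟩
pair-⟦⟧ p q h = trans (pair-⊖ (p ⊛ q) (q ⊛ p) h) (cong₂ _-_ (pair-⊛ p q h) (pair-⊛ q p h))

adᵀ : (Word → ℚ) → ℕ → Word → ℚ
adᵀ h k v = h (k ∷ v) - h (v ++ k ∷ [])

pair-⟦b,mono⟧ : (k : ℕ) (v : Word) (h : Word → ℚ) → ⟨ ⟦ b k , mono v ⟧ ∣ h ⟩ ≡ adᵀ h k v
pair-⟦b,mono⟧ k v h = trans (pair-⟦⟧ (b k) (mono v) h)
  (cong₂ _-_ (trans (pair-mono (k ∷ []) (λ u → ⟨ mono v ∣ (λ v′ → h (u ++ v′)) ⟩)) (pair-mono v (λ v′ → h (k ∷ v′))))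
             (trans (pair-mono v (λ v′ → ⟨ b k ∣ (λ u → h (v′ ++ u)) ⟩)) (pair-mono (k ∷ []) (λ u → h (v ++ u)))))

pair-ΣL : {A : Set} (f : ℚ × A → Poly) (g : A → Poly) → (∀ c a → f (c , a) ≡ c · g a) →
          (X : List (ℚ × A)) (h : Word → ℚ) → ⟨ ΣL f X ∣ h ⟩ ≡ ⟨ X ∣ (λ a → ⟨ g a ∣ h ⟩) ⟩
pair-ΣL f g f≡ [] h = refl
pair-ΣL f g f≡ ((c , a) ∷ X) h rewrite f≡ c a =
  trans (pair-++ (c · g a) (ΣL f X) h) (cong₂ _+_ (pair-· c (g a) h) (pair-ΣL f g f≡ X h))

indicator : Word → Word → ℚ
indicator w v with ≡-dec ℕ._≟_ v w
... | yes _ = 1ℚ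
... | no  _ = 0ℚ

coeff-pairing : (p : Poly) (w : Word) → coeff p w ≡ ⟨ p ∣ indicator w ⟩
coeff-pairing [] w = refl
coeff-pairing ((c , v) ∷ p) w with ≡-dec ℕ._≟_ v w
... | yes _ = cong₂ _+_ (sym (ℚP.*-identityʳ c)) (coeff-pairing p w)
... | no  _ = trans (coeff-pairing p w) (sym (solve 2 (λ c y → c :* con 0ℚ :+ y := y) refl c ⟨ p ∣ indicator w ⟩))

≈-by-pairing : (p q : Poly) → (∀ h → ⟨ p ∣ h ⟩ ≡ ⟨ q ∣ h ⟩) → p ≈ q
≈-by-pairing p q p≗q w = trans (coeff-pairing p w) (trans (p≗q (indicator w)) (sym (coeff-pairing q w)))

derivᵀ : (ℕ → Poly) → Word → (Word → ℚ) → ℚ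
derivᵀ d w h = ⟨ derivWord d w ∣ h ⟩

pair-derivExt : (d : ℕ → Poly) (p : Poly) (h : Word → ℚ) → ⟨ derivExt d p ∣ h ⟩ ≡ ⟨ p ∣ (λ w → derivᵀ d w h) ⟩
pair-derivExt d p h = pair-ΣL _ (derivWord d) (λ c w → refl) p h

module _ (d : ℕ → Poly) where

  derivᵀ-cong : (w : Word) {f g : Word → ℚ} → (∀ v → f v ≡ g v) → derivᵀ d w f ≡ derivᵀ d w g
  derivᵀ-cong w = pair-cong (derivWord d w)

  derivᵀ-add : (w : Word) (f g : Word → ℚ) → derivᵀ d w (λ v → f v + g v) ≡ derivᵀ d w f + derivᵀ d w g
  derivᵀ-add w = pair-add (derivWord d w)

  derivᵀ-sub : (w : Word) (f g : Word → ℚ) → derivᵀ d w (λ v → f v - g v) ≡ derivᵀ d w f - derivᵀ d w g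
  derivᵀ-sub w = pair-sub (derivWord d w)

  derivᵀ-∷ : (x : ℕ) (w : Word) (h : Word → ℚ) →
             derivᵀ d (x ∷ w) h ≡ ⟨ d x ∣ (λ u → h (u ++ w)) ⟩ + derivᵀ d w (λ v → h (x ∷ v))
  derivᵀ-∷ x w h = begin
    ⟨ d x ⊛ mono w ⊕ mono (x ∷ []) ⊛ derivWord d w ∣ h ⟩
      ≡⟨ pair-++ (d x ⊛ mono w) (mono (x ∷ []) ⊛ derivWord d w) h ⟩
    ⟨ d x ⊛ mono w ∣ h ⟩ + ⟨ mono (x ∷ []) ⊛ derivWord d w ∣ h ⟩
      ≡⟨ cong₂ _+_ (trans (pair-⊛ (d x) (mono w) h) (pair-cong (d x) (λ u → pair-mono w (λ v → h (u ++ v)))))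
                   (trans (pair-⊛ (mono (x ∷ [])) (derivWord d w) h) (pair-mono (x ∷ []) (λ u → derivᵀ d w (λ v → h (u ++ v))))) ⟩
    ⟨ d x ∣ (λ u → h (u ++ w)) ⟩ + derivᵀ d w (λ v → h (x ∷ v)) ∎

  derivᵀ-single : (x : ℕ) (h : Word → ℚ) → derivᵀ d (x ∷ []) h ≡ ⟨ d x ∣ h ⟩
  derivᵀ-single x h = begin
    derivᵀ d (x ∷ []) h                 ≡⟨ derivᵀ-∷ x [] h ⟩
    ⟨ d x ∣ (λ u → h (u ++ [])) ⟩ + 0ℚ  ≡⟨ ℚP.+-identityʳ _ ⟩
    ⟨ d x ∣ (λ u → h (u ++ [])) ⟩       ≡⟨ pair-cong (d x) (λ u → cong h (LP.++-identityʳ u)) ⟩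
    ⟨ d x ∣ h ⟩                         ∎

  derivᵀ-++ : (u v : Word) (h : Word → ℚ) →
              derivᵀ d (u ++ v) h ≡ derivᵀ d u (λ x → h (x ++ v)) + derivᵀ d v (λ y → h (u ++ y))
  derivᵀ-++ [] v h = sym (ℚP.+-identityˡ _)
  derivᵀ-++ (x ∷ u) v h = begin
    derivᵀ d (x ∷ u ++ v) h
      ≡⟨ derivᵀ-∷ x (u ++ v) h ⟩
    ⟨ d x ∣ (λ a → h (a ++ u ++ v)) ⟩ + derivᵀ d (u ++ v) (λ y → h (x ∷ y))
      ≡⟨ cong₂ _+_ (pair-cong (d x) (λ a → cong h (sym (LP.++-assoc a u v)))) (derivᵀ-++ u v (λ y → h (x ∷ y))) ⟩
    ⟨ d x ∣ (λ a → h ((a ++ u) ++ v)) ⟩ + (derivᵀ d u (λ z → h (x ∷ z ++ v)) + derivᵀ d v (λ y → h (x ∷ u ++ y)))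
      ≡⟨ ℚP.+-assoc ⟨ d x ∣ (λ a → h ((a ++ u) ++ v)) ⟩ (derivᵀ d u (λ z → h (x ∷ z ++ v))) _ ⟨
    ⟨ d x ∣ (λ a → h ((a ++ u) ++ v)) ⟩ + derivᵀ d u (λ z → h (x ∷ z ++ v)) + derivᵀ d v (λ y → h (x ∷ u ++ y))
      ≡⟨ cong (_+ derivᵀ d v (λ y → h (x ∷ u ++ y))) (derivᵀ-∷ x u (λ z → h (z ++ v))) ⟨
    derivᵀ d (x ∷ u) (λ z → h (z ++ v)) + derivᵀ d v (λ y → h (x ∷ u ++ y)) ∎

derivᵀ-linear : (e d₁ d₂ : ℕ → Poly) (a₁ a₂ : ℚ) →
  (∀ x h → ⟨ e x ∣ h ⟩ ≡ a₁ * ⟨ d₁ x ∣ h ⟩ + a₂ * ⟨ d₂ x ∣ h ⟩) →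
  ∀ w h → derivᵀ e w h ≡ a₁ * derivᵀ d₁ w h + a₂ * derivᵀ d₂ w h
derivᵀ-linear e d₁ d₂ a₁ a₂ e≗ [] h = solve 2 (λ a b → con 0ℚ := a :* con 0ℚ :+ b :* con 0ℚ) refl a₁ a₂
derivᵀ-linear e d₁ d₂ a₁ a₂ e≗ (x ∷ w) h = begin
  derivᵀ e (x ∷ w) h
    ≡⟨ derivᵀ-∷ e x w h ⟩
  ⟨ e x ∣ hw ⟩ + derivᵀ e w hx
    ≡⟨ cong₂ _+_ (e≗ x hw) (derivᵀ-linear e d₁ d₂ a₁ a₂ e≗ w hx) ⟩
  (a₁ * ⟨ d₁ x ∣ hw ⟩ + a₂ * ⟨ d₂ x ∣ hw ⟩) + (a₁ * derivᵀ d₁ w hx + a₂ * derivᵀ d₂ w hx)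
    ≡⟨ solve 6 (λ a b i₁ i₂ e₁ e₂ → (a :* i₁ :+ b :* i₂) :+ (a :* e₁ :+ b :* e₂) := a :* (i₁ :+ e₁) :+ b :* (i₂ :+ e₂))
         refl a₁ a₂ ⟨ d₁ x ∣ hw ⟩ ⟨ d₂ x ∣ hw ⟩ (derivᵀ d₁ w hx) (derivᵀ d₂ w hx) ⟩
  a₁ * (⟨ d₁ x ∣ hw ⟩ + derivᵀ d₁ w hx) + a₂ * (⟨ d₂ x ∣ hw ⟩ + derivᵀ d₂ w hx)
    ≡⟨ cong₂ (λ p q → a₁ * p + a₂ * q) (derivᵀ-∷ d₁ x w h) (derivᵀ-∷ d₂ x w h) ⟨
  a₁ * derivᵀ d₁ (x ∷ w) h + a₂ * derivᵀ d₂ (x ∷ w) h ∎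
  where
  hw hx : Word → ℚ
  hw u = h (u ++ w)
  hx v = h (x ∷ v)

-- Transposition reverses composition: this says e = [d₁, d₂] on letters implies it everywhere.
derivᵀ-commutator : (e d₁ d₂ : ℕ → Poly) →
  (∀ x h → ⟨ e x ∣ h ⟩ ≡ ⟨ d₂ x ∣ (λ v → derivᵀ d₁ v h) ⟩ - ⟨ d₁ x ∣ (λ v → derivᵀ d₂ v h) ⟩) →
  ∀ w h → derivᵀ e w h ≡ derivᵀ d₂ w (λ v → derivᵀ d₁ v h) - derivᵀ d₁ w (λ v → derivᵀ d₂ v h)
derivᵀ-commutator e d₁ d₂ e≗ [] h = refl
derivᵀ-commutator e d₁ d₂ e≗ (x ∷ w) h = begin
  derivᵀ e (x ∷ w) h
    ≡⟨ derivᵀ-∷ e x w h ⟩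
  ⟨ e x ∣ hw ⟩ + derivᵀ e w hx
    ≡⟨ cong₂ _+_ (e≗ x hw) (derivᵀ-commutator e d₁ d₂ e≗ w hx) ⟩
  (α₂ - α₁) + (δ₂ - δ₁)
    ≡⟨ solve 6 (λ a₂ a₁ e₂ e₁ c₁ c₂ →
                  (a₂ :- a₁) :+ (e₂ :- e₁) := (a₂ :+ c₁ :+ (c₂ :+ e₂)) :- (a₁ :+ c₂ :+ (c₁ :+ e₁)))
         refl α₂ α₁ δ₂ δ₁ γ₁ γ₂ ⟩
  (α₂ + γ₁ + (γ₂ + δ₂)) - (α₁ + γ₂ + (γ₁ + δ₁))
    ≡⟨ cong₂ _-_ (expand d₁ d₂) (expand d₂ d₁) ⟨
  derivᵀ d₂ (x ∷ w) (λ v → derivᵀ d₁ v h) - derivᵀ d₁ (x ∷ w) (λ v → derivᵀ d₂ v h) ∎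
  where
  hw hx : Word → ℚ
  hw u = h (u ++ w)
  hx v = h (x ∷ v)
  α₂ = ⟨ d₂ x ∣ (λ u → derivᵀ d₁ u hw) ⟩
  α₁ = ⟨ d₁ x ∣ (λ u → derivᵀ d₂ u hw) ⟩
  δ₂ = derivᵀ d₂ w (λ v → derivᵀ d₁ v hx)
  δ₁ = derivᵀ d₁ w (λ v → derivᵀ d₂ v hx)
  γ₁ = derivᵀ d₁ w (λ v → ⟨ d₂ x ∣ (λ u → h (u ++ v)) ⟩)
  γ₂ = derivᵀ d₂ w (λ v → ⟨ d₁ x ∣ (λ u → h (u ++ v)) ⟩)
  -- the mixed terms γ₁, γ₂ occur on both sides and cancel
  expand : (f g : ℕ → Poly) →
    derivᵀ g (x ∷ w) (λ v → derivᵀ f v h)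
    ≡ ⟨ g x ∣ (λ u → derivᵀ f u hw) ⟩ + derivᵀ f w (λ v → ⟨ g x ∣ (λ u → h (u ++ v)) ⟩)
      + (derivᵀ g w (λ v → ⟨ f x ∣ (λ u → h (u ++ v)) ⟩) + derivᵀ g w (λ v → derivᵀ f v hx))
  expand f g = begin
    derivᵀ g (x ∷ w) (λ v → derivᵀ f v h)
      ≡⟨ derivᵀ-∷ g x w (λ v → derivᵀ f v h) ⟩
    ⟨ g x ∣ (λ u → derivᵀ f (u ++ w) h) ⟩ + derivᵀ g w (λ v → derivᵀ f (x ∷ v) h)
      ≡⟨ cong₂ _+_ (trans (pair-cong (g x) (λ u → derivᵀ-++ f u w h)) (trans (pair-add (g x) _ _)
                      (cong (⟨ g x ∣ (λ u → derivᵀ f u hw) ⟩ +_) (pair-swap (g x) (derivWord f w) (λ u y → h (u ++ y))))))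
                   (trans (derivᵀ-cong g w (λ v → derivᵀ-∷ f x v h)) (derivᵀ-add g w _ _)) ⟩
    ⟨ g x ∣ (λ u → derivᵀ f u hw) ⟩ + derivᵀ f w (λ v → ⟨ g x ∣ (λ u → h (u ++ v)) ⟩)
      + (derivᵀ g w (λ v → ⟨ f x ∣ (λ u → h (u ++ v)) ⟩) + derivᵀ g w (λ v → derivᵀ f v hx)) ∎

-- The expansion underlying ∂_w

-- Umbrally (b_l ↔ bˡ⁻¹), Σopts w replaces each letter b_k, k ≥ 1, of w by (b − x)^(k−1);
-- the exponent of x is the first argument of g.
Σopts : Word → (ℕ → Word → ℚ) → ℚ
Σopts w g = ⟨ opts w ∣ uncurry g ⟩

Σopts-cong : (w : Word) {g g′ : ℕ → Word → ℚ} → (∀ s v → g s v ≡ g′ s v) → Σopts w g ≡ Σopts w g′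
Σopts-cong w g≗g′ = pair-cong (opts w) (λ (s , v) → g≗g′ s v)

Σopts-add : (w : Word) (f g : ℕ → Word → ℚ) → Σopts w (λ s v → f s v + g s v) ≡ Σopts w f + Σopts w g
Σopts-add w f g = pair-add (opts w) (uncurry f) (uncurry g)

Σopts-sub : (w : Word) (f g : ℕ → Word → ℚ) → Σopts w (λ s v → f s v - g s v) ≡ Σopts w f - Σopts w g
Σopts-sub w f g = pair-sub (opts w) (uncurry f) (uncurry g)

Σopts-[] : (g : ℕ → Word → ℚ) → Σopts [] g ≡ g 0 []
Σopts-[] g = solve 1 (λ x → con 1ℚ :* x :+ con 0ℚ := x) refl (g 0 [])

Σopts-0∷ : (w : Word) (g : ℕ → Word → ℚ) → Σopts (zero ∷ w) g ≡ Σopts w (λ s v → g s (zero ∷ v))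
Σopts-0∷ w g = pair-map _ (λ (s , v) → (s , zero ∷ v)) (λ c k → refl) (opts w) (uncurry g)

Σopts-suc∷ : (m : ℕ) (w : Word) (g : ℕ → Word → ℚ) →
             Σopts (suc m ∷ w) g ≡ diffPow m (λ j l → Σopts w (λ s v → g (j ℕ.+ s) (suc l ∷ v)))
Σopts-suc∷ m w g = trans
  (pair-concatMap-applyUpTo (λ j → map (λ (c , s , v) → (signedBinom m j * c , j ℕ.+ s , (suc m ∸ j) ∷ v)) (opts w))
                            (λ j → j) (suc m) (uncurry g))
  (sumBelow-cong (suc m) (λ j j≤m → trans
    (pair-map-scaled _ (signedBinom m j) (λ (s , v) → (j ℕ.+ s , (suc m ∸ j) ∷ v)) (λ c k → refl) (opts w) (uncurry g))
    (cong (λ l → signedBinom m j * Σopts w (λ s v → g (j ℕ.+ s) (l ∷ v))) (ℕP.+-∸-assoc 1 (ℕP.≤-pred j≤m)))))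

Σopts-1∷ : (w : Word) (g : ℕ → Word → ℚ) → Σopts (1 ∷ w) g ≡ Σopts w (λ s v → g s (1 ∷ v))
Σopts-1∷ w g = trans (Σopts-suc∷ 0 w g) (solve 1 (λ x → con 1ℚ :* x :+ con 0ℚ := x) refl (Σopts w (λ s v → g s (1 ∷ v))))

Σopts-[suc] : (k : ℕ) (g : ℕ → Word → ℚ) → Σopts (suc k ∷ []) g ≡ diffPow k (λ j l → g j (suc l ∷ []))
Σopts-[suc] k g = trans (Σopts-suc∷ k [] g)
  (diffPow-cong k (λ j l → trans (Σopts-[] (λ s w → g (j ℕ.+ s) (suc l ∷ w))) (cong (λ s → g s (suc l ∷ [])) (ℕP.+-identityʳ j))))

Σopts-++ : (u v : Word) (g : ℕ → Word → ℚ) →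
           Σopts (u ++ v) g ≡ Σopts u (λ t u′ → Σopts v (λ s v′ → g (t ℕ.+ s) (u′ ++ v′)))
Σopts-++ [] v g = sym (Σopts-[] (λ t u′ → Σopts v (λ s v′ → g (t ℕ.+ s) (u′ ++ v′))))
Σopts-++ (zero ∷ u) v g = begin
  Σopts (zero ∷ u ++ v) g
    ≡⟨ Σopts-0∷ (u ++ v) g ⟩
  Σopts (u ++ v) (λ s w → g s (zero ∷ w))
    ≡⟨ Σopts-++ u v (λ s w → g s (zero ∷ w)) ⟩
  Σopts u (λ t u′ → Σopts v (λ s v′ → g (t ℕ.+ s) (zero ∷ u′ ++ v′)))
    ≡⟨ Σopts-0∷ u (λ t u′ → Σopts v (λ s v′ → g (t ℕ.+ s) (u′ ++ v′))) ⟨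
  Σopts (zero ∷ u) (λ t u′ → Σopts v (λ s v′ → g (t ℕ.+ s) (u′ ++ v′))) ∎
Σopts-++ (suc m ∷ u) v g = begin
  Σopts (suc m ∷ u ++ v) g
    ≡⟨ Σopts-suc∷ m (u ++ v) g ⟩
  diffPow m (λ j l → Σopts (u ++ v) (λ s w → g (j ℕ.+ s) (suc l ∷ w)))
    ≡⟨ diffPow-cong m (λ j l → trans (Σopts-++ u v (λ s w → g (j ℕ.+ s) (suc l ∷ w)))
         (Σopts-cong u (λ t u′ → Σopts-cong v (λ s v′ → cong (λ n → g n (suc l ∷ u′ ++ v′)) (sym (ℕP.+-assoc j t s)))))) ⟩
  diffPow m (λ j l → Σopts u (λ t u′ → Σopts v (λ s v′ → g (j ℕ.+ t ℕ.+ s) (suc l ∷ u′ ++ v′))))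
    ≡⟨ Σopts-suc∷ m u (λ t u′ → Σopts v (λ s v′ → g (t ℕ.+ s) (u′ ++ v′))) ⟨
  Σopts (suc m ∷ u) (λ t u′ → Σopts v (λ s v′ → g (t ℕ.+ s) (u′ ++ v′))) ∎

raiseHead : Word → Word
raiseHead [] = []
raiseHead (x ∷ w) = suc x ∷ w

Σopts-pascal : (m : ℕ) (v : Word) (g : ℕ → Word → ℚ) →
  Σopts (suc (suc m) ∷ v) g ≡ Σopts (suc m ∷ v) (λ s w → g s (raiseHead w)) - Σopts (suc m ∷ v) (λ s w → g (suc s) w)
Σopts-pascal m v g = begin
  Σopts (suc (suc m) ∷ v) g
    ≡⟨ Σopts-suc∷ (suc m) v g ⟩
  diffPow (suc m) (λ j l → Σopts v (λ s w → g (j ℕ.+ s) (suc l ∷ w)))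
    ≡⟨ diffPow-suc m (λ j l → Σopts v (λ s w → g (j ℕ.+ s) (suc l ∷ w))) ⟩
  diffPow m (λ j l → Σopts v (λ s w → g (j ℕ.+ s) (suc (suc l) ∷ w)))
    - diffPow m (λ j l → Σopts v (λ s w → g (suc j ℕ.+ s) (suc l ∷ w)))
    ≡⟨ cong₂ _-_ (Σopts-suc∷ m v (λ s w → g s (raiseHead w))) (Σopts-suc∷ m v (λ s w → g (suc s) w)) ⟨
  Σopts (suc m ∷ v) (λ s w → g s (raiseHead w)) - Σopts (suc m ∷ v) (λ s w → g (suc s) w) ∎

Σopts-agree : (m : ℕ) (v : Word) {f f′ : ℕ → Word → ℚ} → (∀ s l w → f s (suc l ∷ w) ≡ f′ s (suc l ∷ w)) →
              Σopts (suc m ∷ v) f ≡ Σopts (suc m ∷ v) f′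
Σopts-agree m v {f} {f′} f≗f′ = begin
  Σopts (suc m ∷ v) f                                                ≡⟨ Σopts-suc∷ m v f ⟩
  diffPow m (λ j l → Σopts v (λ s w → f (j ℕ.+ s) (suc l ∷ w)))
    ≡⟨ diffPow-cong m (λ j l → Σopts-cong v (λ s w → f≗f′ (j ℕ.+ s) l w)) ⟩
  diffPow m (λ j l → Σopts v (λ s w → f′ (j ℕ.+ s) (suc l ∷ w)))     ≡⟨ Σopts-suc∷ m v f′ ⟨
  Σopts (suc m ∷ v) f′                                               ∎

reexpand : ℕ → (ℕ → ℕ → Word → ℚ) → ℕ → Word → ℚ
reexpand n Φ s v = diffPow (n ℕ.+ s) (λ t l → Σopts v (λ s′ v′ → Φ (t ℕ.+ s′) l v′))

-- Umbrally: substituting x = Y − X into ((b − X) − x) gives b − Y.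
SubstitutionLaw : Word → Set
SubstitutionLaw w = ∀ n Φ → Σopts w (reexpand n Φ) ≡ diffPow n (λ j l → Σopts w (λ s v → Φ j (l ℕ.+ s) v))

substitution-[] : SubstitutionLaw []
substitution-[] n Φ = begin
  Σopts [] (reexpand n Φ)
    ≡⟨ Σopts-[] (reexpand n Φ) ⟩
  diffPow (n ℕ.+ 0) (λ t l → Σopts [] (λ s′ v′ → Φ (t ℕ.+ s′) l v′))
    ≡⟨ cong (λ k → diffPow k (λ t l → Σopts [] (λ s′ v′ → Φ (t ℕ.+ s′) l v′))) (ℕP.+-identityʳ n) ⟩
  diffPow n (λ t l → Σopts [] (λ s′ v′ → Φ (t ℕ.+ s′) l v′))
    ≡⟨ diffPow-cong n (λ t l → trans (Σopts-[] (λ s′ v′ → Φ (t ℕ.+ s′) l v′)) (cong (λ k → Φ k l []) (ℕP.+-identityʳ t))) ⟩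
  diffPow n (λ t l → Φ t l [])
    ≡⟨ diffPow-cong n (λ j l → trans (Σopts-[] (λ s v → Φ j (l ℕ.+ s) v)) (cong (λ k → Φ j k []) (ℕP.+-identityʳ l))) ⟨
  diffPow n (λ j l → Σopts [] (λ s v → Φ j (l ℕ.+ s) v)) ∎

substitution-∷ : (a : ℕ) → (∀ v g → Σopts (a ∷ v) g ≡ Σopts v (λ s v′ → g s (a ∷ v′))) →
                 (w : Word) → SubstitutionLaw w → SubstitutionLaw (a ∷ w)
substitution-∷ a a-inert w law n Φ = begin
  Σopts (a ∷ w) (reexpand n Φ)
    ≡⟨ a-inert w (reexpand n Φ) ⟩
  Σopts w (λ s v → reexpand n Φ s (a ∷ v))
    ≡⟨ Σopts-cong w (λ s v → diffPow-cong (n ℕ.+ s) (λ t l → a-inert v (λ s′ v′ → Φ (t ℕ.+ s′) l v′))) ⟩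
  Σopts w (reexpand n (λ m l v′ → Φ m l (a ∷ v′)))
    ≡⟨ law n (λ m l v′ → Φ m l (a ∷ v′)) ⟩
  diffPow n (λ j l → Σopts w (λ s v → Φ j (l ℕ.+ s) (a ∷ v)))
    ≡⟨ diffPow-cong n (λ j l → a-inert w (λ s v → Φ j (l ℕ.+ s) v)) ⟨
  diffPow n (λ j l → Σopts (a ∷ w) (λ s v → Φ j (l ℕ.+ s) v)) ∎

module _ (Φ : ℕ → ℕ → Word → ℚ) where

  atRaised incX incY : ℕ → ℕ → Word → ℚ
  atRaised m l v = Φ m l (raiseHead v)
  incX m l v = Φ (suc m) l v
  incY m l v = Φ m (suc l) v

  reexpand-raiseHead : (n s l : ℕ) (w : Word) →
    reexpand n Φ s (raiseHead (suc l ∷ w)) ≡ reexpand n atRaised s (suc l ∷ w) - reexpand n incX s (suc l ∷ w)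
  reexpand-raiseHead n s l w = begin
    diffPow (n ℕ.+ s) (λ t l′ → Σopts (suc (suc l) ∷ w) (λ s′ v′ → Φ (t ℕ.+ s′) l′ v′))
      ≡⟨ diffPow-cong (n ℕ.+ s) (λ t l′ → trans (Σopts-pascal l w (λ s′ v′ → Φ (t ℕ.+ s′) l′ v′))
           (cong (λ y → Σopts (suc l ∷ w) (λ s′ v′ → atRaised (t ℕ.+ s′) l′ v′) - y)
              (Σopts-cong (suc l ∷ w) (λ s′ v′ → cong (λ k → Φ k l′ v′) (ℕP.+-suc t s′))))) ⟩
    diffPow (n ℕ.+ s) (λ t l′ → Σopts (suc l ∷ w) (λ s′ v′ → atRaised (t ℕ.+ s′) l′ v′)
                               - Σopts (suc l ∷ w) (λ s′ v′ → incX (t ℕ.+ s′) l′ v′))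
      ≡⟨ diffPow-sub (n ℕ.+ s) (λ t l′ → Σopts (suc l ∷ w) (λ s′ v′ → atRaised (t ℕ.+ s′) l′ v′))
                               (λ t l′ → Σopts (suc l ∷ w) (λ s′ v′ → incX (t ℕ.+ s′) l′ v′)) ⟩
    reexpand n atRaised s (suc l ∷ w) - reexpand n incX s (suc l ∷ w) ∎

  reexpand-suc : (n s : ℕ) (v : Word) → reexpand n Φ (suc s) v ≡ reexpand n incY s v - reexpand n incX s v
  reexpand-suc n s v = trans
    (cong (λ k → diffPow k (λ t l → Σopts v (λ s′ v′ → Φ (t ℕ.+ s′) l v′))) (ℕP.+-suc n s))
    (diffPow-suc (n ℕ.+ s) (λ t l → Σopts v (λ s′ v′ → Φ (t ℕ.+ s′) l v′)))

substitution-suc∷ : (w : Word) → SubstitutionLaw w → (m : ℕ) → SubstitutionLaw (suc m ∷ w)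
substitution-suc∷ w law zero = substitution-∷ 1 Σopts-1∷ w law
substitution-suc∷ w law (suc m) n Φ = begin
  Σopts (suc (suc m) ∷ w) (reexpand n Φ)
    ≡⟨ Σopts-pascal m w (reexpand n Φ) ⟩
  Σopts W (λ s v → reexpand n Φ s (raiseHead v)) - Σopts W (λ s v → reexpand n Φ (suc s) v)
    ≡⟨ cong₂ _-_ (trans (Σopts-agree m w (λ s l v → reexpand-raiseHead Φ n s l v)) (Σopts-sub W _ _))
                 (trans (Σopts-cong W (λ s v → reexpand-suc Φ n s v)) (Σopts-sub W _ _)) ⟩
  (L (atRaised Φ) - L (incX Φ)) - (L (incY Φ) - L (incX Φ))
    ≡⟨ solve 3 (λ a b c → (a :- b) :- (c :- b) := a :- c) refl (L (atRaised Φ)) (L (incX Φ)) (L (incY Φ)) ⟩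
  L (atRaised Φ) - L (incY Φ)
    ≡⟨ cong₂ _-_ (law′ n (atRaised Φ)) (law′ n (incY Φ)) ⟩
  R (atRaised Φ) - R (incY Φ)
    ≡⟨ diffPow-sub n (onW (atRaised Φ)) (onW (incY Φ)) ⟨
  diffPow n (λ j l → onW (atRaised Φ) j l - onW (incY Φ) j l)
    ≡⟨ diffPow-cong n (λ j l → trans (Σopts-pascal m w (λ s v → Φ j (l ℕ.+ s) v))
          (cong (λ y → onW (atRaised Φ) j l - y) (Σopts-cong W (λ s v → cong (λ k → Φ j k v) (ℕP.+-suc l s))))) ⟨
  diffPow n (λ j l → Σopts (suc (suc m) ∷ w) (λ s v → Φ j (l ℕ.+ s) v)) ∎
  where
  W = suc m ∷ w
  law′ = substitution-suc∷ w law m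
  onW : (ℕ → ℕ → Word → ℚ) → ℕ → ℕ → ℚ
  onW Ψ j l = Σopts W (λ s v → Ψ j (l ℕ.+ s) v)
  L R : (ℕ → ℕ → Word → ℚ) → ℚ
  L Ψ = Σopts W (reexpand n Ψ)
  R Ψ = diffPow n (onW Ψ)

substitution : (w : Word) → SubstitutionLaw w
substitution [] = substitution-[]
substitution (zero ∷ w) = substitution-∷ zero Σopts-0∷ w (substitution w)
substitution (suc m ∷ w) = substitution-suc∷ w (substitution w) m

∂wordᵀ : ℕ → (Word → ℚ) → Word → ℚ
∂wordᵀ i h w = Σopts w (λ s v → adᵀ h (suc i ℕ.+ s) v)

pair-∂letter : (ψ : Poly) (i : ℕ) (h : Word → ℚ) → ⟨ ∂letter ψ i ∣ h ⟩ ≡ ⟨ ψ ∣ (λ w → ⟨ ∂word w i ∣ h ⟩) ⟩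
pair-∂letter ψ i h = pair-ΣL _ (λ w → ∂word w i) (λ c w → refl) ψ h

pair-∂letter-0 : (ψ : Poly) (h : Word → ℚ) → ⟨ ∂letter ψ 0 ∣ h ⟩ ≡ 0ℚ
pair-∂letter-0 ψ h = trans (pair-∂letter ψ 0 h) (pair-vanish ψ (λ w → refl))

pair-∂letter-suc : (ψ : Poly) (i : ℕ) (h : Word → ℚ) → ⟨ ∂letter ψ (suc i) ∣ h ⟩ ≡ ⟨ ψ ∣ ∂wordᵀ i h ⟩
pair-∂letter-suc ψ i h = trans (pair-∂letter ψ (suc i) h) (pair-cong ψ (λ w → trans
  (pair-ΣL _ (λ (s , v) → ⟦ b (suc i ℕ.+ s) , mono v ⟧) (λ c k → refl) (opts w) h)
  (Σopts-cong w (λ s v → pair-⟦b,mono⟧ (suc i ℕ.+ s) v h))))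

pair-∂ : (ψ p : Poly) (h : Word → ℚ) → ⟨ ∂ ψ p ∣ h ⟩ ≡ ⟨ p ∣ (λ w → derivᵀ (∂letter ψ) w h) ⟩
pair-∂ ψ = pair-derivExt (∂letter ψ)

∂wordᵀ-Σopts : (n : ℕ) (G : ℕ → Word → ℚ) (w : Word) →
  ∂wordᵀ n (λ u → Σopts u G) w ≡ diffPow n (λ j l → ∂wordᵀ l (G j) w)
∂wordᵀ-Σopts n G w = begin
  Σopts w (λ s v → Σopts (suc n ℕ.+ s ∷ v) G - Σopts (v ++ suc n ℕ.+ s ∷ []) G)
    ≡⟨ Σopts-sub w (λ s v → Σopts (suc n ℕ.+ s ∷ v) G) (λ s v → Σopts (v ++ suc n ℕ.+ s ∷ []) G) ⟩
  Σopts w (λ s v → Σopts (suc n ℕ.+ s ∷ v) G) - Σopts w (λ s v → Σopts (v ++ suc n ℕ.+ s ∷ []) G)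
    ≡⟨ cong₂ _-_ (trans (Σopts-cong w (λ s v → Σopts-suc∷ (n ℕ.+ s) v G)) (substitution w n prepend))
                 (trans (Σopts-cong w append-as-reexpand) (substitution w n append)) ⟩
  diffPow n (shifted prepend) - diffPow n (shifted append)
    ≡⟨ diffPow-sub n (shifted prepend) (shifted append) ⟨
  diffPow n (λ j l → shifted prepend j l - shifted append j l)
    ≡⟨ diffPow-cong n (λ j l → Σopts-sub w (λ s → prepend j (l ℕ.+ s)) (λ s → append j (l ℕ.+ s))) ⟨
  diffPow n (λ j l → ∂wordᵀ l (G j) w) ∎
  where
  prepend append : ℕ → ℕ → Word → ℚ
  prepend m l v = G m (suc l ∷ v)
  append m l v = G m (v ++ suc l ∷ [])
  shifted : (ℕ → ℕ → Word → ℚ) → ℕ → ℕ → ℚ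
  shifted Φ j l = Σopts w (λ s v → Φ j (l ℕ.+ s) v)
  append-as-reexpand : (s : ℕ) (v : Word) → Σopts (v ++ suc n ℕ.+ s ∷ []) G ≡ reexpand n append s v
  append-as-reexpand s v = begin
    Σopts (v ++ suc n ℕ.+ s ∷ []) G
      ≡⟨ Σopts-++ v (suc n ℕ.+ s ∷ []) G ⟩
    Σopts v (λ s′ v′ → Σopts (suc (n ℕ.+ s) ∷ []) (λ t a → G (s′ ℕ.+ t) (v′ ++ a)))
      ≡⟨ Σopts-cong v (λ s′ v′ → Σopts-[suc] (n ℕ.+ s) (λ t a → G (s′ ℕ.+ t) (v′ ++ a))) ⟩
    Σopts v (λ s′ v′ → diffPow (n ℕ.+ s) (λ t l → G (s′ ℕ.+ t) (v′ ++ suc l ∷ [])))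
      ≡⟨ diffPow-pair (n ℕ.+ s) (opts v) (λ t l (s′ , v′) → G (s′ ℕ.+ t) (v′ ++ suc l ∷ [])) ⟨
    diffPow (n ℕ.+ s) (λ t l → Σopts v (λ s′ v′ → G (s′ ℕ.+ t) (v′ ++ suc l ∷ [])))
      ≡⟨ diffPow-cong (n ℕ.+ s) (λ t l → Σopts-cong v (λ s′ v′ → cong (λ k → G k (v′ ++ suc l ∷ [])) (ℕP.+-comm s′ t))) ⟩
    reexpand n append s v ∎

pair-∂letter-Σopts : (ψ : Poly) (a : ℕ) (G : ℕ → Word → ℚ) →
  ⟨ ∂letter ψ a ∣ (λ u → Σopts u G) ⟩ ≡ Σopts (a ∷ []) (λ t a′ → derivᵀ (∂letter ψ) a′ (G t))
pair-∂letter-Σopts ψ zero G = begin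
  ⟨ ∂letter ψ 0 ∣ (λ u → Σopts u G) ⟩                          ≡⟨ pair-∂letter-0 ψ _ ⟩
  0ℚ                                                           ≡⟨ pair-∂letter-0 ψ (G 0) ⟨
  ⟨ ∂letter ψ 0 ∣ G 0 ⟩                                         ≡⟨ derivᵀ-single (∂letter ψ) 0 (G 0) ⟨
  derivᵀ (∂letter ψ) (zero ∷ []) (G 0)                         ≡⟨ Σopts-[] (λ s v → derivᵀ (∂letter ψ) (zero ∷ v) (G s)) ⟨
  Σopts [] (λ s v → derivᵀ (∂letter ψ) (zero ∷ v) (G s))       ≡⟨ Σopts-0∷ [] (λ t a′ → derivᵀ (∂letter ψ) a′ (G t)) ⟨
  Σopts (zero ∷ []) (λ t a′ → derivᵀ (∂letter ψ) a′ (G t))     ∎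
pair-∂letter-Σopts ψ (suc n) G = begin
  ⟨ ∂letter ψ (suc n) ∣ (λ u → Σopts u G) ⟩
    ≡⟨ pair-∂letter-suc ψ n (λ u → Σopts u G) ⟩
  ⟨ ψ ∣ ∂wordᵀ n (λ u → Σopts u G) ⟩
    ≡⟨ pair-cong ψ (∂wordᵀ-Σopts n G) ⟩
  ⟨ ψ ∣ (λ w → diffPow n (λ j l → ∂wordᵀ l (G j) w)) ⟩
    ≡⟨ diffPow-pair n ψ (λ j l → ∂wordᵀ l (G j)) ⟨
  diffPow n (λ j l → ⟨ ψ ∣ ∂wordᵀ l (G j) ⟩)
    ≡⟨ diffPow-cong n (λ j l → trans (derivᵀ-single (∂letter ψ) (suc l) (G j)) (pair-∂letter-suc ψ l (G j))) ⟨
  diffPow n (λ j l → derivᵀ (∂letter ψ) (suc l ∷ []) (G j))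
    ≡⟨ Σopts-[suc] n (λ t a′ → derivᵀ (∂letter ψ) a′ (G t)) ⟨
  Σopts (suc n ∷ []) (λ t a′ → derivᵀ (∂letter ψ) a′ (G t)) ∎

derivᵀ-∂-Σopts : (ψ : Poly) (v : Word) (G : ℕ → Word → ℚ) →
  derivᵀ (∂letter ψ) v (λ w → Σopts w G) ≡ Σopts v (λ s w → derivᵀ (∂letter ψ) w (G s))
derivᵀ-∂-Σopts ψ [] G = sym (Σopts-[] (λ s w → derivᵀ (∂letter ψ) w (G s)))
derivᵀ-∂-Σopts ψ (a ∷ v) G = begin
  derivᵀ d (a ∷ v) (λ w → Σopts w G)
    ≡⟨ derivᵀ-∷ d a v (λ w → Σopts w G) ⟩
  ⟨ d a ∣ (λ u → Σopts (u ++ v) G) ⟩ + derivᵀ d v (λ w → Σopts (a ∷ w) G)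
    ≡⟨ cong₂ _+_ head-term tail-term ⟩
  Σopts (a ∷ []) (λ t a′ → Σopts v (λ s v′ → derivᵀ d a′ (λ x → G (t ℕ.+ s) (x ++ v′))))
    + Σopts (a ∷ []) (λ t a′ → Σopts v (λ s v′ → derivᵀ d v′ (λ y → G (t ℕ.+ s) (a′ ++ y))))
    ≡⟨ Σopts-add (a ∷ []) (λ t a′ → Σopts v (λ s v′ → derivᵀ d a′ (λ x → G (t ℕ.+ s) (x ++ v′))))
                          (λ t a′ → Σopts v (λ s v′ → derivᵀ d v′ (λ y → G (t ℕ.+ s) (a′ ++ y)))) ⟨
  Σopts (a ∷ []) (λ t a′ → Σopts v (λ s v′ → derivᵀ d a′ (λ x → G (t ℕ.+ s) (x ++ v′)))
                          + Σopts v (λ s v′ → derivᵀ d v′ (λ y → G (t ℕ.+ s) (a′ ++ y))))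
    ≡⟨ Σopts-cong (a ∷ []) (λ t a′ → trans (Σopts-cong v (λ s v′ → derivᵀ-++ d a′ v′ (G (t ℕ.+ s))))
         (Σopts-add v (λ s v′ → derivᵀ d a′ (λ x → G (t ℕ.+ s) (x ++ v′))) (λ s v′ → derivᵀ d v′ (λ y → G (t ℕ.+ s) (a′ ++ y))))) ⟨
  Σopts (a ∷ []) (λ t a′ → Σopts v (λ s v′ → derivᵀ d (a′ ++ v′) (G (t ℕ.+ s))))
    ≡⟨ Σopts-++ (a ∷ []) v (λ s w → derivᵀ d w (G s)) ⟨
  Σopts (a ∷ v) (λ s w → derivᵀ d w (G s)) ∎
  where
  d = ∂letter ψ
  head-term : ⟨ d a ∣ (λ u → Σopts (u ++ v) G) ⟩
            ≡ Σopts (a ∷ []) (λ t a′ → Σopts v (λ s v′ → derivᵀ d a′ (λ x → G (t ℕ.+ s) (x ++ v′))))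
  head-term = begin
    ⟨ d a ∣ (λ u → Σopts (u ++ v) G) ⟩
      ≡⟨ pair-cong (d a) (λ u → Σopts-++ u v G) ⟩
    ⟨ d a ∣ (λ u → Σopts u (λ t u′ → Σopts v (λ s v′ → G (t ℕ.+ s) (u′ ++ v′)))) ⟩
      ≡⟨ pair-∂letter-Σopts ψ a (λ t u′ → Σopts v (λ s v′ → G (t ℕ.+ s) (u′ ++ v′))) ⟩
    Σopts (a ∷ []) (λ t a′ → derivᵀ d a′ (λ u′ → Σopts v (λ s v′ → G (t ℕ.+ s) (u′ ++ v′))))
      ≡⟨ Σopts-cong (a ∷ []) (λ t a′ → pair-swap (derivWord d a′) (opts v) (λ u′ (s , v′) → G (t ℕ.+ s) (u′ ++ v′))) ⟩
    Σopts (a ∷ []) (λ t a′ → Σopts v (λ s v′ → derivᵀ d a′ (λ x → G (t ℕ.+ s) (x ++ v′)))) ∎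
  tail-term : derivᵀ d v (λ w → Σopts (a ∷ w) G)
            ≡ Σopts (a ∷ []) (λ t a′ → Σopts v (λ s v′ → derivᵀ d v′ (λ y → G (t ℕ.+ s) (a′ ++ y))))
  tail-term = begin
    derivᵀ d v (λ w → Σopts (a ∷ w) G)
      ≡⟨ derivᵀ-cong d v (λ w → Σopts-++ (a ∷ []) w G) ⟩
    derivᵀ d v (λ w → Σopts (a ∷ []) (λ t a′ → Σopts w (λ s w′ → G (t ℕ.+ s) (a′ ++ w′))))
      ≡⟨ pair-swap (derivWord d v) (opts (a ∷ [])) (λ w (t , a′) → Σopts w (λ s w′ → G (t ℕ.+ s) (a′ ++ w′))) ⟩
    Σopts (a ∷ []) (λ t a′ → derivᵀ d v (λ w → Σopts w (λ s w′ → G (t ℕ.+ s) (a′ ++ w′))))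
      ≡⟨ Σopts-cong (a ∷ []) (λ t a′ → derivᵀ-∂-Σopts ψ v (λ s w′ → G (t ℕ.+ s) (a′ ++ w′))) ⟩
    Σopts (a ∷ []) (λ t a′ → Σopts v (λ s v′ → derivᵀ d v′ (λ y → G (t ℕ.+ s) (a′ ++ y)))) ∎

-- The letter identity for {ψ₁,ψ₂}_A

brᵀ : (Word → ℚ) → Word → Word → ℚ
brᵀ h v u = h (u ++ v) - h (v ++ u)

adᵀ-derivᵀ : (d : ℕ → Poly) (k : ℕ) (v : Word) (h : Word → ℚ) →
  adᵀ (λ w → derivᵀ d w h) k v ≡ derivᵀ d v (adᵀ h k) + ⟨ d k ∣ brᵀ h v ⟩
adᵀ-derivᵀ d k v h = begin
  derivᵀ d (k ∷ v) h - derivᵀ d (v ++ k ∷ []) h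
    ≡⟨ cong₂ _-_ (derivᵀ-∷ d k v h) (trans (derivᵀ-++ d v (k ∷ []) h) (cong (c +_) (derivᵀ-single d k (λ y → h (v ++ y))))) ⟩
  (a + bb) - (c + e)
    ≡⟨ solve 4 (λ a b c e → (a :+ b) :- (c :+ e) := (b :- c) :+ (a :- e)) refl a bb c e ⟩
  (bb - c) + (a - e)
    ≡⟨ cong₂ _+_ (derivᵀ-sub d v (λ v′ → h (k ∷ v′)) (λ v′ → h (v′ ++ k ∷ []))) (pair-sub (d k) _ _) ⟨
  derivᵀ d v (adᵀ h k) + ⟨ d k ∣ brᵀ h v ⟩ ∎
  where
  a = ⟨ d k ∣ (λ u → h (u ++ v)) ⟩
  bb = derivᵀ d v (λ v′ → h (k ∷ v′))
  c = derivᵀ d v (λ x → h (x ++ k ∷ []))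
  e = ⟨ d k ∣ (λ u → h (v ++ u)) ⟩

adᵀ-jacobi : (h : Word → ℚ) (N : ℕ) (u v : Word) →
  adᵀ h N (u ++ v) - adᵀ h N (v ++ u) ≡ adᵀ (brᵀ h v) N u - adᵀ (brᵀ h u) N v
adᵀ-jacobi h N u v
  rewrite LP.++-assoc u (N ∷ []) v | LP.++-assoc v (N ∷ []) u | LP.++-assoc u v (N ∷ []) | LP.++-assoc v u (N ∷ []) =
  solve 6 (λ a b c d e f → (a :- f) :- (e :- d) := ((a :- b) :- (c :- d)) :- ((e :- c) :- (b :- f))) refl
    (h (N ∷ u ++ v)) (h (v ++ N ∷ u)) (h (u ++ N ∷ v)) (h (v ++ u ++ N ∷ [])) (h (N ∷ v ++ u)) (h (u ++ v ++ N ∷ []))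

pair-⟪⟫A : (ψ₁ ψ₂ : Poly) (g : Word → ℚ) →
  ⟨ ⟪ ψ₁ , ψ₂ ⟫A ∣ g ⟩
  ≡ (⟨ ψ₂ ∣ (λ u → derivᵀ (∂letter ψ₁) u g) ⟩ - ⟨ ψ₁ ∣ (λ u → derivᵀ (∂letter ψ₂) u g) ⟩) + ⟨ ⟦ ψ₁ , ψ₂ ⟧ ∣ g ⟩
pair-⟪⟫A ψ₁ ψ₂ g = trans (pair-++ (∂ ψ₁ ψ₂ ⊖ ∂ ψ₂ ψ₁) ⟦ ψ₁ , ψ₂ ⟧ g)
  (cong (_+ ⟨ ⟦ ψ₁ , ψ₂ ⟧ ∣ g ⟩)
    (trans (pair-⊖ (∂ ψ₁ ψ₂) (∂ ψ₂ ψ₁) g) (cong₂ _-_ (pair-∂ ψ₁ ψ₂ g) (pair-∂ ψ₂ ψ₁ g))))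

-- The part of ∂_ψ (∂_ψ′ b_{i+1}) where ∂_ψ hits the letter b_{i+1+s} of a bracket [b_{i+1+s}, w(𝐥)].
hitLetter : Poly → Poly → ℕ → (Word → ℚ) → ℚ
hitLetter ψ ψ′ i h = ⟨ ψ′ ∣ (λ w → Σopts w (λ s v → ⟨ ψ ∣ ∂wordᵀ (i ℕ.+ s) (brᵀ h v) ⟩)) ⟩

∂-∂letter-remainder : (ψ ψ′ : Poly) (i : ℕ) (h : Word → ℚ) →
  ⟨ ∂letter ψ′ (suc i) ∣ (λ v → derivᵀ (∂letter ψ) v h) ⟩ - ⟨ ψ′ ∣ (λ w → derivᵀ (∂letter ψ) w (∂wordᵀ i h)) ⟩
  ≡ hitLetter ψ ψ′ i h
∂-∂letter-remainder ψ ψ′ i h = begin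
  ⟨ ∂letter ψ′ (suc i) ∣ (λ v → derivᵀ d v h) ⟩ - ⟨ ψ′ ∣ (λ w → derivᵀ d w (∂wordᵀ i h)) ⟩
    ≡⟨ cong₂ _-_ (pair-∂letter-suc ψ′ i (λ v → derivᵀ d v h))
                 (pair-cong ψ′ (λ w → derivᵀ-∂-Σopts ψ w (λ s → adᵀ h (suc i ℕ.+ s)))) ⟩
  ⟨ ψ′ ∣ (λ w → Σopts w (λ s v → adᵀ (λ y → derivᵀ d y h) (suc i ℕ.+ s) v)) ⟩
    - ⟨ ψ′ ∣ (λ w → Σopts w (λ s v → derivᵀ d v (adᵀ h (suc i ℕ.+ s)))) ⟩
    ≡⟨ pair-sub ψ′ _ _ ⟨
  ⟨ ψ′ ∣ (λ w → Σopts w (λ s v → adᵀ (λ y → derivᵀ d y h) (suc i ℕ.+ s) v)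
              - Σopts w (λ s v → derivᵀ d v (adᵀ h (suc i ℕ.+ s)))) ⟩
    ≡⟨ pair-cong ψ′ (λ w → trans (sym (Σopts-sub w _ _)) (Σopts-cong w (λ s v → leibniz (suc i ℕ.+ s) v))) ⟩
  ⟨ ψ′ ∣ (λ w → Σopts w (λ s v → ⟨ d (suc (i ℕ.+ s)) ∣ brᵀ h v ⟩)) ⟩
    ≡⟨ pair-cong ψ′ (λ w → Σopts-cong w (λ s v → pair-∂letter-suc ψ (i ℕ.+ s) (brᵀ h v))) ⟩
  ⟨ ψ′ ∣ (λ w → Σopts w (λ s v → ⟨ ψ ∣ ∂wordᵀ (i ℕ.+ s) (brᵀ h v) ⟩)) ⟩ ∎
  where
  d = ∂letter ψ
  leibniz : ∀ k v → adᵀ (λ y → derivᵀ d y h) k v - derivᵀ d v (adᵀ h k) ≡ ⟨ d k ∣ brᵀ h v ⟩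
  leibniz k v = trans (cong (_- derivᵀ d v (adᵀ h k)) (adᵀ-derivᵀ d k v h))
    (solve 2 (λ x y → (x :+ y) :- x := y) refl (derivᵀ d v (adᵀ h k)) ⟨ d k ∣ brᵀ h v ⟩)

Σopts² : Poly → Poly → (ℕ → Word → ℕ → Word → ℚ) → ℚ
Σopts² ψ₁ ψ₂ F = ⟨ ψ₁ ∣ (λ u → ⟨ ψ₂ ∣ (λ w → Σopts u (λ t u′ → Σopts w (λ s v → F t u′ s v))) ⟩) ⟩

Σopts²-cong : (ψ₁ ψ₂ : Poly) {F G : ℕ → Word → ℕ → Word → ℚ} → (∀ t u s v → F t u s v ≡ G t u s v) →
              Σopts² ψ₁ ψ₂ F ≡ Σopts² ψ₁ ψ₂ G
Σopts²-cong ψ₁ ψ₂ F≗G =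
  pair-cong ψ₁ (λ u → pair-cong ψ₂ (λ w → Σopts-cong u (λ t u′ → Σopts-cong w (λ s v → F≗G t u′ s v))))

Σopts²-sub : (ψ₁ ψ₂ : Poly) (F G : ℕ → Word → ℕ → Word → ℚ) →
             Σopts² ψ₁ ψ₂ (λ t u s v → F t u s v - G t u s v) ≡ Σopts² ψ₁ ψ₂ F - Σopts² ψ₁ ψ₂ G
Σopts²-sub ψ₁ ψ₂ F G = trans
  (pair-cong ψ₁ (λ u → trans
    (pair-cong ψ₂ (λ w → trans (Σopts-cong u (λ t u′ → Σopts-sub w (F t u′) (G t u′))) (Σopts-sub u _ _)))
    (pair-sub ψ₂ _ _)))
  (pair-sub ψ₁ _ _)

adᵀ-jacobi-shifted : (h : Word → ℚ) (i s t : ℕ) (u v : Word) →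
  adᵀ (brᵀ h v) (suc (i ℕ.+ s) ℕ.+ t) u - adᵀ (brᵀ h u) (suc (i ℕ.+ t) ℕ.+ s) v
  ≡ adᵀ h (suc i ℕ.+ (t ℕ.+ s)) (u ++ v) - adᵀ h (suc i ℕ.+ (s ℕ.+ t)) (v ++ u)
adᵀ-jacobi-shifted h i s t u v = begin
  adᵀ (brᵀ h v) (suc (i ℕ.+ s) ℕ.+ t) u - adᵀ (brᵀ h u) (suc (i ℕ.+ t) ℕ.+ s) v
    ≡⟨ cong₂ (λ m m′ → adᵀ (brᵀ h v) m u - adᵀ (brᵀ h u) m′ v)
         (cong suc (ℕP.+-assoc i s t)) (cong suc (trans (ℕP.+-assoc i t s) (cong (i ℕ.+_) (ℕP.+-comm t s)))) ⟩
  adᵀ (brᵀ h v) N u - adᵀ (brᵀ h u) N v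
    ≡⟨ adᵀ-jacobi h N u v ⟨
  adᵀ h N (u ++ v) - adᵀ h N (v ++ u)
    ≡⟨ cong (λ m → adᵀ h (suc (i ℕ.+ m)) (u ++ v) - adᵀ h N (v ++ u)) (ℕP.+-comm t s) ⟨
  adᵀ h (suc i ℕ.+ (t ℕ.+ s)) (u ++ v) - adᵀ h (suc i ℕ.+ (s ℕ.+ t)) (v ++ u) ∎
  where
  N = suc i ℕ.+ (s ℕ.+ t)

hitLetter-jacobi : (ψ₁ ψ₂ : Poly) (i : ℕ) (h : Word → ℚ) →
  hitLetter ψ₁ ψ₂ i h - hitLetter ψ₂ ψ₁ i h ≡ ⟨ ⟦ ψ₁ , ψ₂ ⟧ ∣ ∂wordᵀ i h ⟩
hitLetter-jacobi ψ₁ ψ₂ i h = begin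
  hitLetter ψ₁ ψ₂ i h - hitLetter ψ₂ ψ₁ i h
    ≡⟨ cong₂ _-_ hit₁₂-expanded hit₂₁-expanded ⟩
  Σopts² ψ₁ ψ₂ nested₁₂ - Σopts² ψ₁ ψ₂ nested₂₁
    ≡⟨ Σopts²-sub ψ₁ ψ₂ nested₁₂ nested₂₁ ⟨
  Σopts² ψ₁ ψ₂ (λ t u s v → nested₁₂ t u s v - nested₂₁ t u s v)
    ≡⟨ Σopts²-cong ψ₁ ψ₂ (λ t u s v → adᵀ-jacobi-shifted h i s t u v) ⟩
  Σopts² ψ₁ ψ₂ (λ t u s v → concat₁₂ t u s v - concat₂₁ t u s v)
    ≡⟨ Σopts²-sub ψ₁ ψ₂ concat₁₂ concat₂₁ ⟩
  Σopts² ψ₁ ψ₂ concat₁₂ - Σopts² ψ₁ ψ₂ concat₂₁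
    ≡⟨ cong₂ _-_ product₁₂-expanded product₂₁-expanded ⟨
  ⟨ ψ₁ ∣ (λ u → ⟨ ψ₂ ∣ (λ w → ∂wordᵀ i h (u ++ w)) ⟩) ⟩ - ⟨ ψ₂ ∣ (λ w → ⟨ ψ₁ ∣ (λ u → ∂wordᵀ i h (w ++ u)) ⟩) ⟩
    ≡⟨ pair-⟦⟧ ψ₁ ψ₂ (∂wordᵀ i h) ⟨
  ⟨ ⟦ ψ₁ , ψ₂ ⟧ ∣ ∂wordᵀ i h ⟩ ∎
  where
  nested₁₂ nested₂₁ concat₁₂ concat₂₁ : ℕ → Word → ℕ → Word → ℚ
  nested₁₂ t u s v = adᵀ (brᵀ h v) (suc (i ℕ.+ s) ℕ.+ t) u
  nested₂₁ t u s v = adᵀ (brᵀ h u) (suc (i ℕ.+ t) ℕ.+ s) v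
  concat₁₂ t u s v = adᵀ h (suc i ℕ.+ (t ℕ.+ s)) (u ++ v)
  concat₂₁ t u s v = adᵀ h (suc i ℕ.+ (s ℕ.+ t)) (v ++ u)
  hit₁₂-expanded : hitLetter ψ₁ ψ₂ i h ≡ Σopts² ψ₁ ψ₂ nested₁₂
  hit₁₂-expanded =
    trans (pair-cong ψ₂ (λ w → pair-swap (opts w) ψ₁ (λ (s , v) u → ∂wordᵀ (i ℕ.+ s) (brᵀ h v) u)))
    (trans (pair-swap ψ₂ ψ₁ (λ w u → Σopts w (λ s v → ∂wordᵀ (i ℕ.+ s) (brᵀ h v) u)))
      (pair-cong ψ₁ (λ u → pair-cong ψ₂ (λ w →
        pair-swap (opts w) (opts u) (λ (s , v) (t , u′) → nested₁₂ t u′ s v)))))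
  hit₂₁-expanded : hitLetter ψ₂ ψ₁ i h ≡ Σopts² ψ₁ ψ₂ nested₂₁
  hit₂₁-expanded = pair-cong ψ₁ (λ u → pair-swap (opts u) ψ₂ (λ (t , u′) w → ∂wordᵀ (i ℕ.+ t) (brᵀ h u′) w))
  product₁₂-expanded : ⟨ ψ₁ ∣ (λ u → ⟨ ψ₂ ∣ (λ w → ∂wordᵀ i h (u ++ w)) ⟩) ⟩ ≡ Σopts² ψ₁ ψ₂ concat₁₂
  product₁₂-expanded = pair-cong ψ₁ (λ u → pair-cong ψ₂ (λ w → Σopts-++ u w (λ s → adᵀ h (suc i ℕ.+ s))))
  product₂₁-expanded : ⟨ ψ₂ ∣ (λ w → ⟨ ψ₁ ∣ (λ u → ∂wordᵀ i h (w ++ u)) ⟩) ⟩ ≡ Σopts² ψ₁ ψ₂ concat₂₁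
  product₂₁-expanded =
    trans (pair-cong ψ₂ (λ w → pair-cong ψ₁ (λ u → Σopts-++ w u (λ s → adᵀ h (suc i ℕ.+ s)))))
    (trans (pair-swap ψ₂ ψ₁ (λ w u → Σopts w (λ s v → Σopts u (λ t u′ → concat₂₁ t u′ s v))))
      (pair-cong ψ₁ (λ u → pair-cong ψ₂ (λ w →
        pair-swap (opts w) (opts u) (λ (s , v) (t , u′) → concat₂₁ t u′ s v)))))

∂letter-⟪⟫A : (ψ₁ ψ₂ : Poly) (i : ℕ) (h : Word → ℚ) →
  ⟨ ∂letter ⟪ ψ₁ , ψ₂ ⟫A i ∣ h ⟩
  ≡ ⟨ ∂letter ψ₂ i ∣ (λ v → derivᵀ (∂letter ψ₁) v h) ⟩ - ⟨ ∂letter ψ₁ i ∣ (λ v → derivᵀ (∂letter ψ₂) v h) ⟩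
∂letter-⟪⟫A ψ₁ ψ₂ zero h = begin
  ⟨ ∂letter ⟪ ψ₁ , ψ₂ ⟫A 0 ∣ h ⟩  ≡⟨ pair-∂letter-0 ⟪ ψ₁ , ψ₂ ⟫A h ⟩
  0ℚ                            ≡⟨ cong₂ _-_ (pair-∂letter-0 ψ₂ _) (pair-∂letter-0 ψ₁ _) ⟨
  ⟨ ∂letter ψ₂ 0 ∣ (λ v → derivᵀ (∂letter ψ₁) v h) ⟩ - ⟨ ∂letter ψ₁ 0 ∣ (λ v → derivᵀ (∂letter ψ₂) v h) ⟩ ∎
∂letter-⟪⟫A ψ₁ ψ₂ (suc i) h = begin
  ⟨ ∂letter ⟪ ψ₁ , ψ₂ ⟫A (suc i) ∣ h ⟩
    ≡⟨ pair-∂letter-suc ⟪ ψ₁ , ψ₂ ⟫A i h ⟩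
  ⟨ ⟪ ψ₁ , ψ₂ ⟫A ∣ ∂wordᵀ i h ⟩
    ≡⟨ pair-⟪⟫A ψ₁ ψ₂ (∂wordᵀ i h) ⟩
  (X₁₂ - X₂₁) + ⟨ ⟦ ψ₁ , ψ₂ ⟧ ∣ ∂wordᵀ i h ⟩
    ≡⟨ cong ((X₁₂ - X₂₁) +_) (hitLetter-jacobi ψ₁ ψ₂ i h) ⟨
  (X₁₂ - X₂₁) + (hitLetter ψ₁ ψ₂ i h - hitLetter ψ₂ ψ₁ i h)
    ≡⟨ cong₂ (λ a c → (X₁₂ - X₂₁) + (a - c)) (∂-∂letter-remainder ψ₁ ψ₂ i h) (∂-∂letter-remainder ψ₂ ψ₁ i h) ⟨
  (X₁₂ - X₂₁) + ((Y₁₂ - X₁₂) - (Y₂₁ - X₂₁))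
    ≡⟨ solve 4 (λ x₁ x₂ y₁ y₂ → (x₁ :- x₂) :+ ((y₁ :- x₁) :- (y₂ :- x₂)) := y₁ :- y₂)
         refl X₁₂ X₂₁ Y₁₂ Y₂₁ ⟩
  Y₁₂ - Y₂₁ ∎
  where
  X₁₂ = ⟨ ψ₂ ∣ (λ u → derivᵀ (∂letter ψ₁) u (∂wordᵀ i h)) ⟩
  X₂₁ = ⟨ ψ₁ ∣ (λ u → derivᵀ (∂letter ψ₂) u (∂wordᵀ i h)) ⟩
  Y₁₂ = ⟨ ∂letter ψ₂ (suc i) ∣ (λ v → derivᵀ (∂letter ψ₁) v h) ⟩
  Y₂₁ = ⟨ ∂letter ψ₁ (suc i) ∣ (λ v → derivᵀ (∂letter ψ₂) v h) ⟩

-- The actions σ and σ⁰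

σᵀ : Poly → (Word → ℚ) → Word → ℚ
σᵀ ψ h w = ⟨ ψ ∣ (λ u → h (u ++ w)) ⟩ + derivᵀ (∂letter ψ) w h

pair-σ : (ψ x : Poly) (h : Word → ℚ) → ⟨ σ ψ x ∣ h ⟩ ≡ ⟨ x ∣ σᵀ ψ h ⟩
pair-σ ψ x h = begin
  ⟨ ψ ⊛ x ⊕ ∂ ψ x ∣ h ⟩
    ≡⟨ pair-++ (ψ ⊛ x) (∂ ψ x) h ⟩
  ⟨ ψ ⊛ x ∣ h ⟩ + ⟨ ∂ ψ x ∣ h ⟩
    ≡⟨ cong₂ _+_ (trans (pair-⊛ ψ x h) (pair-swap ψ x (λ u v → h (u ++ v)))) (pair-∂ ψ x h) ⟩
  ⟨ x ∣ (λ w → ⟨ ψ ∣ (λ u → h (u ++ w)) ⟩) ⟩ + ⟨ x ∣ (λ w → derivᵀ (∂letter ψ) w h) ⟩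
    ≡⟨ pair-add x _ _ ⟨
  ⟨ x ∣ σᵀ ψ h ⟩ ∎

σᵀ-⟪⟫A : (ψ₁ ψ₂ : Poly) (h : Word → ℚ) (w : Word) →
         σᵀ ⟪ ψ₁ , ψ₂ ⟫A h w ≡ σᵀ ψ₂ (σᵀ ψ₁ h) w - σᵀ ψ₁ (σᵀ ψ₂ h) w
σᵀ-⟪⟫A ψ₁ ψ₂ h w = begin
  ⟨ ⟪ ψ₁ , ψ₂ ⟫A ∣ (λ u → h (u ++ w)) ⟩ + derivᵀ (∂letter ⟪ ψ₁ , ψ₂ ⟫A) w h
    ≡⟨ cong₂ _+_ (trans (pair-⟪⟫A ψ₁ ψ₂ (λ u → h (u ++ w)))
                        (cong ((ℓ∂ ψ₂ ψ₁ - ℓ∂ ψ₁ ψ₂) +_) (pair-⟦⟧ ψ₁ ψ₂ (λ u → h (u ++ w)))))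
                 (derivᵀ-commutator (∂letter ⟪ ψ₁ , ψ₂ ⟫A) (∂letter ψ₁) (∂letter ψ₂) (∂letter-⟪⟫A ψ₁ ψ₂) w h) ⟩
  ((ℓ∂ ψ₂ ψ₁ - ℓ∂ ψ₁ ψ₂) + (ℓℓ′ ψ₁ ψ₂ - ℓℓ′ ψ₂ ψ₁)) + (∂∂ ψ₂ ψ₁ - ∂∂ ψ₁ ψ₂)
    ≡⟨ cong₂ (λ a c → ((ℓ∂ ψ₂ ψ₁ - ℓ∂ ψ₁ ψ₂) + (a - c)) + (∂∂ ψ₂ ψ₁ - ∂∂ ψ₁ ψ₂))
             (ℓℓ′≡ℓℓ ψ₁ ψ₂) (ℓℓ′≡ℓℓ ψ₂ ψ₁) ⟩
  ((ℓ∂ ψ₂ ψ₁ - ℓ∂ ψ₁ ψ₂) + (ℓℓ ψ₂ ψ₁ - ℓℓ ψ₁ ψ₂)) + (∂∂ ψ₂ ψ₁ - ∂∂ ψ₁ ψ₂)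
    ≡⟨ solve 8 (λ a₂ a₁ z₁ z₂ e₂ e₁ c₁₂ c₂₁ →
           ((a₂ :- a₁) :+ (z₁ :- z₂)) :+ (e₂ :- e₁)
           := (z₁ :+ (a₂ :+ c₁₂) :+ (c₂₁ :+ e₂)) :- (z₂ :+ (a₁ :+ c₂₁) :+ (c₁₂ :+ e₁)))
         refl (ℓ∂ ψ₂ ψ₁) (ℓ∂ ψ₁ ψ₂) (ℓℓ ψ₂ ψ₁) (ℓℓ ψ₁ ψ₂)
              (∂∂ ψ₂ ψ₁) (∂∂ ψ₁ ψ₂) (∂ℓ ψ₁ ψ₂) (∂ℓ ψ₂ ψ₁) ⟩
  (ℓℓ ψ₂ ψ₁ + (ℓ∂ ψ₂ ψ₁ + ∂ℓ ψ₁ ψ₂) + (∂ℓ ψ₂ ψ₁ + ∂∂ ψ₂ ψ₁))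
    - (ℓℓ ψ₁ ψ₂ + (ℓ∂ ψ₁ ψ₂ + ∂ℓ ψ₂ ψ₁) + (∂ℓ ψ₁ ψ₂ + ∂∂ ψ₁ ψ₂))
    ≡⟨ cong₂ _-_ (expand ψ₂ ψ₁) (expand ψ₁ ψ₂) ⟨
  σᵀ ψ₂ (σᵀ ψ₁ h) w - σᵀ ψ₁ (σᵀ ψ₂ h) w ∎
  where
  ℓℓ ℓℓ′ ℓ∂ ∂ℓ ∂∂ : Poly → Poly → ℚ
  ℓℓ ψ ψ′ = ⟨ ψ ∣ (λ u → ⟨ ψ′ ∣ (λ u′ → h (u′ ++ u ++ w)) ⟩) ⟩
  ℓℓ′ ψ ψ′ = ⟨ ψ ∣ (λ u → ⟨ ψ′ ∣ (λ u′ → h ((u ++ u′) ++ w)) ⟩) ⟩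
  ℓ∂ ψ ψ′ = ⟨ ψ ∣ (λ u → derivᵀ (∂letter ψ′) u (λ x → h (x ++ w))) ⟩
  ∂ℓ ψ ψ′ = derivᵀ (∂letter ψ) w (λ v → ⟨ ψ′ ∣ (λ u′ → h (u′ ++ v)) ⟩)
  ∂∂ ψ ψ′ = derivᵀ (∂letter ψ) w (λ v → derivᵀ (∂letter ψ′) v h)
  ℓℓ′≡ℓℓ : (ψ ψ′ : Poly) → ℓℓ′ ψ ψ′ ≡ ℓℓ ψ′ ψ
  ℓℓ′≡ℓℓ ψ ψ′ = trans (pair-swap ψ ψ′ (λ u u′ → h ((u ++ u′) ++ w)))
    (pair-cong ψ′ (λ u′ → pair-cong ψ (λ u → cong h (LP.++-assoc u u′ w))))
  expand : (ψ ψ′ : Poly) → σᵀ ψ (σᵀ ψ′ h) w ≡ ℓℓ ψ ψ′ + (ℓ∂ ψ ψ′ + ∂ℓ ψ′ ψ) + (∂ℓ ψ ψ′ + ∂∂ ψ ψ′)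
  expand ψ ψ′ = cong₂ _+_
    (trans (pair-add ψ _ _) (cong (ℓℓ ψ ψ′ +_)
      (trans (pair-cong ψ (λ u → derivᵀ-++ (∂letter ψ′) u w h)) (trans (pair-add ψ _ _)
        (cong (ℓ∂ ψ ψ′ +_) (pair-swap ψ (derivWord (∂letter ψ′) w) (λ u y → h (u ++ y))))))))
    (derivᵀ-add (∂letter ψ) w _ _)

pair-σ-⟪⟫A : (ψ₁ ψ₂ x : Poly) (h : Word → ℚ) →
  ⟨ σ ⟪ ψ₁ , ψ₂ ⟫A x ∣ h ⟩ ≡ ⟨ σ ψ₁ (σ ψ₂ x) ∣ h ⟩ - ⟨ σ ψ₂ (σ ψ₁ x) ∣ h ⟩
pair-σ-⟪⟫A ψ₁ ψ₂ x h = begin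
  ⟨ σ ⟪ ψ₁ , ψ₂ ⟫A x ∣ h ⟩
    ≡⟨ pair-σ ⟪ ψ₁ , ψ₂ ⟫A x h ⟩
  ⟨ x ∣ σᵀ ⟪ ψ₁ , ψ₂ ⟫A h ⟩
    ≡⟨ pair-cong x (σᵀ-⟪⟫A ψ₁ ψ₂ h) ⟩
  ⟨ x ∣ (λ w → σᵀ ψ₂ (σᵀ ψ₁ h) w - σᵀ ψ₁ (σᵀ ψ₂ h) w) ⟩
    ≡⟨ pair-sub x _ _ ⟩
  ⟨ x ∣ σᵀ ψ₂ (σᵀ ψ₁ h) ⟩ - ⟨ x ∣ σᵀ ψ₁ (σᵀ ψ₂ h) ⟩
    ≡⟨ cong₂ _-_ (trans (pair-σ ψ₁ (σ ψ₂ x) h) (pair-σ ψ₂ x (σᵀ ψ₁ h)))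
                 (trans (pair-σ ψ₂ (σ ψ₁ x) h) (pair-σ ψ₁ x (σᵀ ψ₂ h))) ⟨
  ⟨ σ ψ₁ (σ ψ₂ x) ∣ h ⟩ - ⟨ σ ψ₂ (σ ψ₁ x) ∣ h ⟩ ∎

π₀ᵀ : (Word → ℚ) → Word → ℚ
π₀ᵀ h w = if endsIn0 w then 0ℚ else h w

pair-π₀ : (p : Poly) (h : Word → ℚ) → ⟨ π₀ p ∣ h ⟩ ≡ ⟨ p ∣ π₀ᵀ h ⟩
pair-π₀ [] h = refl
pair-π₀ ((c , w) ∷ p) h with endsIn0 w
... | true  = trans (pair-π₀ p h) (sym (solve 2 (λ c y → c :* con 0ℚ :+ y := y) refl c ⟨ p ∣ π₀ᵀ h ⟩))
... | false = cong (c * h w +_) (pair-π₀ p h)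

VanishesOnB₀ : (Word → ℚ) → Set
VanishesOnB₀ h = ∀ w → endsIn0 w ≡ true → h w ≡ 0ℚ

π₀ᵀ-vanishes : (h : Word → ℚ) → VanishesOnB₀ (π₀ᵀ h)
π₀ᵀ-vanishes h w ends0 = cong (λ e → if e then 0ℚ else h w) ends0

π₀ᵀ-fixes : (h : Word → ℚ) → VanishesOnB₀ h → ∀ w → π₀ᵀ h w ≡ h w
π₀ᵀ-fixes h h-vanishes w with endsIn0 w in ends
... | true  = sym (h-vanishes w ends)
... | false = refl

endsIn0-++ : (u w : Word) → endsIn0 w ≡ true → endsIn0 (u ++ w) ≡ true
endsIn0-++ [] w ends0 = ends0
endsIn0-++ (x ∷ []) [] ()
endsIn0-++ (x ∷ []) (y ∷ w) ends0 = ends0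
endsIn0-++ (x ∷ z ∷ u) w ends0 = endsIn0-++ (z ∷ u) w ends0

derivᵀ-∂-vanishes : (ψ : Poly) (h : Word → ℚ) → VanishesOnB₀ h → VanishesOnB₀ (λ w → derivᵀ (∂letter ψ) w h)
derivᵀ-∂-vanishes ψ h h-vanishes [] ()
derivᵀ-∂-vanishes ψ h h-vanishes (suc x ∷ []) ()
derivᵀ-∂-vanishes ψ h h-vanishes (zero ∷ []) ends0 = trans (derivᵀ-single (∂letter ψ) 0 h) (pair-∂letter-0 ψ h)
derivᵀ-∂-vanishes ψ h h-vanishes (x ∷ y ∷ w) ends0 = begin
  derivᵀ (∂letter ψ) (x ∷ y ∷ w) h
    ≡⟨ derivᵀ-∷ (∂letter ψ) x (y ∷ w) h ⟩
  ⟨ ∂letter ψ x ∣ (λ u → h (u ++ y ∷ w)) ⟩ + derivᵀ (∂letter ψ) (y ∷ w) (λ v → h (x ∷ v))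
    ≡⟨ cong₂ _+_ (pair-vanish (∂letter ψ x) (λ u → h-vanishes (u ++ y ∷ w) (endsIn0-++ u (y ∷ w) ends0)))
                 (derivᵀ-∂-vanishes ψ (λ v → h (x ∷ v)) (λ v → h-vanishes (x ∷ v) ∘ endsIn0-++ (x ∷ []) v) (y ∷ w) ends0) ⟩
  0ℚ + 0ℚ ∎

σᵀ-vanishes : (ψ : Poly) (h : Word → ℚ) → VanishesOnB₀ h → VanishesOnB₀ (σᵀ ψ h)
σᵀ-vanishes ψ h h-vanishes w ends0 =
  cong₂ _+_ (pair-vanish ψ (λ u → h-vanishes (u ++ w) (endsIn0-++ u w ends0))) (derivᵀ-∂-vanishes ψ h h-vanishes w ends0)

-- σ_ψ preserves ℚ⟨B⟩b₀, so π₀ ∘ σ_ψ ∘ π₀ = π₀ ∘ σ_ψ.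
pair-σ⁰-π₀ : (ψ y : Poly) (h : Word → ℚ) → ⟨ σ⁰ ψ (π₀ y) ∣ h ⟩ ≡ ⟨ σ⁰ ψ y ∣ h ⟩
pair-σ⁰-π₀ ψ y h = begin
  ⟨ π₀ (σ ψ (π₀ y)) ∣ h ⟩      ≡⟨ trans (pair-π₀ (σ ψ (π₀ y)) h) (pair-σ ψ (π₀ y) (π₀ᵀ h)) ⟩
  ⟨ π₀ y ∣ σᵀ ψ (π₀ᵀ h) ⟩       ≡⟨ pair-π₀ y (σᵀ ψ (π₀ᵀ h)) ⟩
  ⟨ y ∣ π₀ᵀ (σᵀ ψ (π₀ᵀ h)) ⟩    ≡⟨ pair-cong y (π₀ᵀ-fixes _ (σᵀ-vanishes ψ (π₀ᵀ h) (π₀ᵀ-vanishes h))) ⟩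
  ⟨ y ∣ σᵀ ψ (π₀ᵀ h) ⟩          ≡⟨ trans (pair-π₀ (σ ψ y) h) (pair-σ ψ y (π₀ᵀ h)) ⟨
  ⟨ π₀ (σ ψ y) ∣ h ⟩            ∎

σᵀ-linear : (a₁ a₂ : ℚ) (ψ₁ ψ₂ : Poly) (h : Word → ℚ) (w : Word) →
            σᵀ (a₁ · ψ₁ ⊕ a₂ · ψ₂) h w ≡ a₁ * σᵀ ψ₁ h w + a₂ * σᵀ ψ₂ h w
σᵀ-linear a₁ a₂ ψ₁ ψ₂ h w = begin
  ⟨ a₁ · ψ₁ ⊕ a₂ · ψ₂ ∣ hw ⟩ + derivᵀ (∂letter (a₁ · ψ₁ ⊕ a₂ · ψ₂)) w h
    ≡⟨ cong₂ _+_ (pair-·⊕· a₁ a₂ ψ₁ ψ₂ hw) (derivᵀ-linear _ (∂letter ψ₁) (∂letter ψ₂) a₁ a₂ ∂letter-linear w h) ⟩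
  (a₁ * ⟨ ψ₁ ∣ hw ⟩ + a₂ * ⟨ ψ₂ ∣ hw ⟩) + (a₁ * derivᵀ (∂letter ψ₁) w h + a₂ * derivᵀ (∂letter ψ₂) w h)
    ≡⟨ solve 6 (λ a b x y z t → (a :* x :+ b :* y) :+ (a :* z :+ b :* t) := a :* (x :+ z) :+ b :* (y :+ t))
         refl a₁ a₂ ⟨ ψ₁ ∣ hw ⟩ ⟨ ψ₂ ∣ hw ⟩ (derivᵀ (∂letter ψ₁) w h) (derivᵀ (∂letter ψ₂) w h) ⟩
  a₁ * σᵀ ψ₁ h w + a₂ * σᵀ ψ₂ h w ∎
  where
  hw : Word → ℚ
  hw u = h (u ++ w)
  ∂letter-linear : ∀ x g →
    ⟨ ∂letter (a₁ · ψ₁ ⊕ a₂ · ψ₂) x ∣ g ⟩ ≡ a₁ * ⟨ ∂letter ψ₁ x ∣ g ⟩ + a₂ * ⟨ ∂letter ψ₂ x ∣ g ⟩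
  ∂letter-linear x g = begin
    ⟨ ∂letter (a₁ · ψ₁ ⊕ a₂ · ψ₂) x ∣ g ⟩
      ≡⟨ pair-∂letter (a₁ · ψ₁ ⊕ a₂ · ψ₂) x g ⟩
    ⟨ a₁ · ψ₁ ⊕ a₂ · ψ₂ ∣ (λ w′ → ⟨ ∂word w′ x ∣ g ⟩) ⟩
      ≡⟨ pair-·⊕· a₁ a₂ ψ₁ ψ₂ _ ⟩
    a₁ * ⟨ ψ₁ ∣ (λ w′ → ⟨ ∂word w′ x ∣ g ⟩) ⟩ + a₂ * ⟨ ψ₂ ∣ (λ w′ → ⟨ ∂word w′ x ∣ g ⟩) ⟩
      ≡⟨ cong₂ (λ p q → a₁ * p + a₂ * q) (pair-∂letter ψ₁ x g) (pair-∂letter ψ₂ x g) ⟨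
    a₁ * ⟨ ∂letter ψ₁ x ∣ g ⟩ + a₂ * ⟨ ∂letter ψ₂ x ∣ g ⟩ ∎

σ⁰-linear : (a₁ a₂ : ℚ) (ψ₁ ψ₂ x : Poly) → σ⁰ (a₁ · ψ₁ ⊕ a₂ · ψ₂) x ≈ a₁ · σ⁰ ψ₁ x ⊕ a₂ · σ⁰ ψ₂ x
σ⁰-linear a₁ a₂ ψ₁ ψ₂ x =
  ≈-by-pairing (σ⁰ (a₁ · ψ₁ ⊕ a₂ · ψ₂) x) (a₁ · σ⁰ ψ₁ x ⊕ a₂ · σ⁰ ψ₂ x) λ h → begin
  ⟨ σ⁰ (a₁ · ψ₁ ⊕ a₂ · ψ₂) x ∣ h ⟩
    ≡⟨ pair-σ⁰ (a₁ · ψ₁ ⊕ a₂ · ψ₂) h ⟩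
  ⟨ x ∣ σᵀ (a₁ · ψ₁ ⊕ a₂ · ψ₂) (π₀ᵀ h) ⟩
    ≡⟨ pair-cong x (σᵀ-linear a₁ a₂ ψ₁ ψ₂ (π₀ᵀ h)) ⟩
  ⟨ x ∣ (λ w → a₁ * σᵀ ψ₁ (π₀ᵀ h) w + a₂ * σᵀ ψ₂ (π₀ᵀ h) w) ⟩
    ≡⟨ trans (pair-add x _ _) (cong₂ _+_ (pair-scale x a₁ _) (pair-scale x a₂ _)) ⟩
  a₁ * ⟨ x ∣ σᵀ ψ₁ (π₀ᵀ h) ⟩ + a₂ * ⟨ x ∣ σᵀ ψ₂ (π₀ᵀ h) ⟩
    ≡⟨ cong₂ (λ p q → a₁ * p + a₂ * q) (pair-σ⁰ ψ₁ h) (pair-σ⁰ ψ₂ h) ⟨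
  a₁ * ⟨ σ⁰ ψ₁ x ∣ h ⟩ + a₂ * ⟨ σ⁰ ψ₂ x ∣ h ⟩
    ≡⟨ pair-·⊕· a₁ a₂ (σ⁰ ψ₁ x) (σ⁰ ψ₂ x) h ⟨
  ⟨ a₁ · σ⁰ ψ₁ x ⊕ a₂ · σ⁰ ψ₂ x ∣ h ⟩ ∎
  where
  pair-σ⁰ : (ψ : Poly) (h : Word → ℚ) → ⟨ σ⁰ ψ x ∣ h ⟩ ≡ ⟨ x ∣ σᵀ ψ (π₀ᵀ h) ⟩
  pair-σ⁰ ψ h = trans (pair-π₀ (σ ψ x) h) (pair-σ ψ x (π₀ᵀ h))

σ⁰-⟪⟫A : (ψ₁ ψ₂ x : Poly) → σ⁰ ⟪ ψ₁ , ψ₂ ⟫A x ≈ σ⁰ ψ₁ (σ⁰ ψ₂ x) ⊖ σ⁰ ψ₂ (σ⁰ ψ₁ x)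
σ⁰-⟪⟫A ψ₁ ψ₂ x =
  ≈-by-pairing (σ⁰ ⟪ ψ₁ , ψ₂ ⟫A x) (σ⁰ ψ₁ (σ⁰ ψ₂ x) ⊖ σ⁰ ψ₂ (σ⁰ ψ₁ x)) λ h → begin
  ⟨ π₀ (σ ⟪ ψ₁ , ψ₂ ⟫A x) ∣ h ⟩
    ≡⟨ pair-π₀ (σ ⟪ ψ₁ , ψ₂ ⟫A x) h ⟩
  ⟨ σ ⟪ ψ₁ , ψ₂ ⟫A x ∣ π₀ᵀ h ⟩
    ≡⟨ pair-σ-⟪⟫A ψ₁ ψ₂ x (π₀ᵀ h) ⟩
  ⟨ σ ψ₁ (σ ψ₂ x) ∣ π₀ᵀ h ⟩ - ⟨ σ ψ₂ (σ ψ₁ x) ∣ π₀ᵀ h ⟩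
    ≡⟨ cong₂ _-_ (trans (pair-σ⁰-π₀ ψ₁ (σ ψ₂ x) h) (pair-π₀ (σ ψ₁ (σ ψ₂ x)) h))
                 (trans (pair-σ⁰-π₀ ψ₂ (σ ψ₁ x) h) (pair-π₀ (σ ψ₂ (σ ψ₁ x)) h)) ⟨
  ⟨ σ⁰ ψ₁ (σ⁰ ψ₂ x) ∣ h ⟩ - ⟨ σ⁰ ψ₂ (σ⁰ ψ₁ x) ∣ h ⟩
    ≡⟨ pair-⊖ (σ⁰ ψ₁ (σ⁰ ψ₂ x)) (σ⁰ ψ₂ (σ⁰ ψ₁ x)) h ⟨
  ⟨ σ⁰ ψ₁ (σ⁰ ψ₂ x) ⊖ σ⁰ ψ₂ (σ⁰ ψ₁ x) ∣ h ⟩ ∎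

-- Both identities hold for all ψ₁, ψ₂ ∈ ℚ⟨B⟩ and x ∈ ℚ⟨B⟩.
proposition2p8 :
  ((a₁ a₂ : ℚ) (ψ₁ ψ₂ x : Poly) → IsLie ψ₁ → IsLie ψ₂ → In⁰ x →
     σ⁰ (a₁ · ψ₁ ⊕ a₂ · ψ₂) x ≈ a₁ · σ⁰ ψ₁ x ⊕ a₂ · σ⁰ ψ₂ x)
  ×
  ((ψ₁ ψ₂ x : Poly) → IsLie ψ₁ → IsLie ψ₂ → In⁰ x →
     σ⁰ ⟪ ψ₁ , ψ₂ ⟫A x ≈ σ⁰ ψ₁ (σ⁰ ψ₂ x) ⊖ σ⁰ ψ₂ (σ⁰ ψ₁ x))
proposition2p8 =
  (λ a₁ a₂ ψ₁ ψ₂ x _ _ _ → σ⁰-linear a₁ a₂ ψ₁ ψ₂ x) , (λ ψ₁ ψ₂ x _ _ _ → σ⁰-⟪⟫A ψ₁ ψ₂ x)
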